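{- Let $\lambda=(a,1^b)$ be a hook shape ($a\ge1$, $b\ge0$). Then, as operators on $\mathbf F$, \[ s_\lambda(\mathbf u)=\sum_T u_{\mathrm{reading}(T)}, \] where the sum is over all fillings $T$ of the boxes of $\lambda$ by integers (of any sign) which are strictly increasing from left to right along the first row and strictly increasing from top to bottom down the first column.
   Context: Fix an integer $n\ge 1$. Partitions are drawn in English notation; the box in row $r$ and column $c$ lies on diagonal $c-r$. An $n$-ribbon is a connected skew shape with $n$ boxes containing no $2\times 2$ square; its head is its top-right box, and its spin is its number of rows minus $1$. Let $K=\mathbb{C}(q)$ and let $\mathbf F$ be the $K$-vector space with basis the set of all partitions. For $i\in\mathbb{Z}$, $u_i\in\mathrm{End}_K(\mathbf F)$ is defined by $u_i(\lambda)=q^{\mathrm{spin}(\mu/\lambda)}\mu$ if there is a partition $\mu$ with $\mu/\lambda$ an $n$-ribbon with head on diagonal $i$, else $0$. Let $h_k(\mathbf u)=\sum_{i_1<\cdots<i_k}u_{i_k}\cdots u_{i_1}$, $h_0(\mathbf u)=1$, $h_k(\mathbf u)=0$ for $k<0$; these operators pairwise commute, and $s_\lambda(\mathbf u)=\det\big(h_{\lambda_i-i+j}(\mathbf u)\big)_{i,j=1}^{\ell(\lambda)}$. The reading word $\mathrm{reading}(T)$ of a filling $T$ is obtained by reading the top row from right to left, then each subsequent row from right to left, going downwards; for a word $w=w_1w_2\cdots w_k$ set $u_w=u_{w_1}u_{w_2}\cdots u_{w_k}$. Infinite sums of operators here are well defined since only finitely many terms act nontrivially on a given partition. -}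

module Defs where

open import Data.Nat as ℕ using (ℕ; zero; suc; _+_; _∸_; _≤_; _≡ᵇ_; _<ᵇ_; _⊓_; _⊔_)
open import Data.Integer as ℤ using (ℤ; +_; -[1+_])
open import Data.Bool using (Bool; true; false; _∧_; _∨_; not; if_then_else_)
open import Data.List using (List; []; _∷_; [_]; _++_; map; concatMap; length; upTo; replicate; reverse; foldr; take)
open import Data.Nat.ListAction using (sum)
open import Data.Bool.ListAction using (all; any)
import Data.List.Properties
open import Data.List.Relation.Unary.All using (All)
open import Data.List.Relation.Unary.Linked using (Linked)
open import Data.Product using (_×_; _,_; proj₁; proj₂)
open import Relation.Nullary.Decidable using (⌊_⌋)
open import Relation.Binary.PropositionalEquality using (_≡_)

-- Partitions: weakly decreasing lists of positive naturals (row lengths).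
-- Boxes are (row , column), 0-indexed; diagonal = column - row.

IsPartition : List ℕ → Set
IsPartition p = Linked (λ x y → y ≤ x) p × All (λ x → 1 ≤ x) p

rowLen : List ℕ → ℕ → ℕ
rowLen []       _       = 0
rowLen (x ∷ _)  zero    = x
rowLen (_ ∷ xs) (suc r) = rowLen xs r

size : List ℕ → ℕ
size = sum

Box : Set
Box = ℕ × ℕ

diag : Box → ℤ
diag (r , c) = + c ℤ.- + r

range : ℕ → ℕ → List ℕ
range a b = map (λ k → a ℕ.+ k) (upTo (b ∸ a))

contained : List ℕ → List ℕ → Bool
contained κ μ = all (λ r → rowLen κ r ℕ.≤ᵇ rowLen μ r) (upTo (length κ))

skewBoxes : List ℕ → List ℕ → List Box
skewBoxes κ μ = concatMap (λ r → map (λ c → (r , c)) (range (rowLen κ r) (rowLen μ r))) (upTo (length μ))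

boxEq : Box → Box → Bool
boxEq (r , c) (r' , c') = (r ≡ᵇ r') ∧ (c ≡ᵇ c')

mem : Box → List Box → Bool
mem b bs = any (boxEq b) bs

adjacent : Box → Box → Bool
adjacent (r , c) (r' , c') =
  ((r ≡ᵇ r') ∧ ((suc c ≡ᵇ c') ∨ (suc c' ≡ᵇ c))) ∨ ((c ≡ᵇ c') ∧ ((suc r ≡ᵇ r') ∨ (suc r' ≡ᵇ r)))

iterate : ℕ → (List Box → List Box) → List Box → List Box
iterate zero    f s = s
iterate (suc k) f s = iterate k f (f s)

-- connectedness of a finite set of boxes (via edge adjacency): the set of
-- boxes reachable from the first box (|bs| closure steps) is everything
connected : List Box → Bool
connected []       = true
connected (b ∷ bs) = all (λ x → mem x reach) (b ∷ bs)
  where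
  step : List Box → List Box
  step s = Data.List.filterᵇ (λ x → mem x s ∨ any (adjacent x) s) (b ∷ bs)
  reach : List Box
  reach = iterate (length (b ∷ bs)) step (b ∷ [])

no2x2 : List Box → Bool
no2x2 bs = not (any (λ { (r , c) → mem (r , suc c) bs ∧ (mem (suc r , c) bs ∧ mem (suc r , suc c) bs) }) bs)

isRibbon : ℕ → List ℕ → List ℕ → Bool
isRibbon n κ μ = contained κ μ ∧ ((length (skewBoxes κ μ) ≡ᵇ n) ∧ (connected (skewBoxes κ μ) ∧ no2x2 (skewBoxes κ μ)))

headOf : List Box → Box
headOf []             = (0 , 0)
headOf ((r₀ , c₀) ∷ bs) = (top , right)
  where
  top : ℕ
  top = foldr _⊓_ r₀ (map proj₁ bs)
  right : ℕ
  right = foldr _⊔_ 0 (map proj₂ (Data.List.filterᵇ (λ b → proj₁ b ≡ᵇ top) ((r₀ , c₀) ∷ bs)))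

distinct : List ℕ → List ℕ
distinct []       = []
distinct (x ∷ xs) = x ∷ Data.List.filterᵇ (λ y → not (y ≡ᵇ x)) (distinct xs)

spin : List Box → ℕ
spin bs = length (distinct (map proj₁ bs)) ∸ 1

partsF : ℕ → ℕ → ℕ → List (List ℕ)
partsF zero    m k = if m ≡ᵇ 0 then [ [] ] else []
partsF (suc f) m k = if m ≡ᵇ 0 then [ [] ] else
  concatMap (λ p → map (p ∷_) (partsF f (m ∸ p) p)) (range 1 (suc (m ⊓ k)))

partitionsOf : ℕ → List (List ℕ)
partitionsOf m = partsF m m m

-- The module F (over ℤ[q] ⊂ ℂ(q)): finite formal sums of terms c·q^e·μ.

Term : Set
Term = ℤ × ℕ × List ℕ

LC : Set
LC = List Term

Op : Set
Op = List ℕ → LC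

coeff : ℕ → List ℕ → LC → ℤ
coeff e ν []                   = + 0
coeff e ν ((c , e' , μ) ∷ ts) =
  (if (e ≡ᵇ e') ∧ ⌊ Data.List.Properties.≡-dec ℕ._≟_ ν μ ⌋ then c else + 0) ℤ.+ coeff e ν ts

_≈_ : LC → LC → Set
L ≈ L' = ∀ (e : ℕ) (ν : List ℕ) → coeff e ν L ≡ coeff e ν L'

applyOp : Op → LC → LC
applyOp f = concatMap (λ { (c , e , μ) → map (λ { (c' , e' , ν) → (c ℤ.* c' , e + e' , ν) }) (f μ) })

_∘ₒ_ : Op → Op → Op
(f ∘ₒ g) μ = applyOp f (g μ)

idOp : Op
idOp μ = [ (+ 1 , 0 , μ) ]

zeroOp : Op
zeroOp _ = []

_+ₒ_ : Op → Op → Op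
(f +ₒ g) μ = f μ ++ g μ

negOp : Op → Op
negOp f μ = map (λ { (c , e , ν) → (ℤ.- c , e , ν) }) (f μ)

sumOps : List Op → Op
sumOps = foldr _+ₒ_ zeroOp

u : ℕ → ℤ → Op
u n i κ = concatMap
  (λ μ → if isRibbon n κ μ ∧ ⌊ diag (headOf (skewBoxes κ μ)) ℤ.≟ i ⌋
         then [ (+ 1 , spin (skewBoxes κ μ) , μ) ] else [])
  (partitionsOf (size κ + n))

uWord : ℕ → List ℤ → Op
uWord n w = foldr (λ i acc → u n i ∘ₒ acc) idOp w

window : ℕ → List ℤ
window N = map (λ k → + k ℤ.- + N) (upTo (suc (N + N)))

incSeqs : ℕ → List ℤ → List (List ℤ)
incSeqs zero    _        = [ [] ]
incSeqs (suc k) []       = []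
incSeqs (suc k) (x ∷ xs) = map (x ∷_) (incSeqs k xs) ++ incSeqs (suc k) xs

-- h_k(u) truncated to diagonals in [-N, N]: Σ_{i₁<⋯<i_k} u_{i_k} ⋯ u_{i₁}
hTrunc : ℕ → ℕ → ℤ → Op
hTrunc n N (+ k)     = sumOps (map (λ s → uWord n (reverse s)) (incSeqs k (window N)))
hTrunc n N -[1+ _ ]  = zeroOp

-- determinant of a square matrix of (commuting) operators, Laplace
-- expansion along the first row (= Leibniz with products in row order)
lookupD : List Op → ℕ → Op
lookupD []       _       = zeroOp
lookupD (x ∷ _)  zero    = x
lookupD (_ ∷ xs) (suc j) = lookupD xs j

dropIdx : {A : Set} → ℕ → List A → List A
dropIdx _       []       = []
dropIdx zero    (_ ∷ xs) = xs
dropIdx (suc j) (x ∷ xs) = x ∷ dropIdx j xs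

isEven : ℕ → Bool
isEven zero          = true
isEven (suc zero)    = false
isEven (suc (suc k)) = isEven k

detF : ℕ → List (List Op) → Op
detF _       []           = idOp
detF zero    (_ ∷ _)      = zeroOp
detF (suc f) (row ∷ rows) = sumOps (map (λ j →
    (if isEven j then (λ g → g) else negOp)
      (lookupD row j ∘ₒ detF f (map (dropIdx j) rows)))
  (upTo (length row)))

det : List (List Op) → Op
det M = detF (length M) M

schurTrunc : ℕ → ℕ → List ℕ → Op
schurTrunc n N κ = det (map (λ i → map (λ j → hTrunc n N ((+ rowLen κ i ℤ.- + i) ℤ.+ + j))
                                        (upTo (length κ)))
                            (upTo (length κ)))

-- Fillings: a filling of shape κ is a list of rows of integers.

listsOfLen : ℕ → List ℤ → List (List ℤ)
listsOfLen zero    W = [ [] ]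
listsOfLen (suc l) W = concatMap (λ x → map (x ∷_) (listsOfLen l W)) W

fillingsOf : List ℤ → List ℕ → List (List (List ℤ))
fillingsOf W []       = [ [] ]
fillingsOf W (l ∷ ls) = concatMap (λ row → map (row ∷_) (fillingsOf W ls)) (listsOfLen l W)

strictInc : List ℤ → Bool
strictInc []           = true
strictInc (x ∷ [])     = true
strictInc (x ∷ y ∷ xs) = ⌊ x ℤ.<? y ⌋ ∧ strictInc (y ∷ xs)

firstRow : List (List ℤ) → List ℤ
firstRow []      = []
firstRow (r ∷ _) = r

firstCol : List (List ℤ) → List ℤ
firstCol T = concatMap (take 1) T

hookCondition : List (List ℤ) → Bool
hookCondition T = strictInc (firstRow T) ∧ strictInc (firstCol T)

reading : List (List ℤ) → List ℤ
reading T = concatMap reverse T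

fillingSum : ℕ → ℕ → List ℕ → Op
fillingSum n N κ = sumOps (map (λ T → uWord n (reading T))
                                (Data.List.filterᵇ hookCondition (fillingsOf (window N) κ)))

hook : ℕ → ℕ → List ℕ
hook a b = a ∷ replicate b 1

{-# OPTIONS --safe #-}
module Submission where

-- For hooks the only relation needed is u_i u_i = 0: two stacked n-ribbons never have their heads
-- on the same diagonal. Write H(a, b) for the sum over the fillings of the hook (1 + a, 1^b) with
-- corner x, first row x ∷ r and first column x ∷ c. The product h_(k+1) H(0, l) is the sum of the
-- words rev(x ∷ r) ++ y ∷ c over increasing rows x ∷ r and columns y ∷ c; the terms with x < y are
-- the fillings with corner x and column x ∷ y ∷ c, those with y < x the fillings with corner y and
-- row y ∷ x ∷ r, and those with x = y vanish. So h_(k+1) H(0, l) = H(k, l + 1) + H(k + 1, l).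
-- Expanding the Jacobi–Trudi determinant of the hook along its first row, the minors reduce by
-- unitriangularity to e_m = det (h_(1-i+j)), which is the column sum H(0, m - 1) by induction on
-- the leg; hence s_(1+a, 1^b) = Σ_j (-1)^j h_(1+a+j) e_(b-j), which telescopes to H(a, b).
-- Nothing depends on the window [-N, N] of diagonals or on κ being a partition, so N₀ = 0 works.

open import Defs
open import Data.Nat using (ℕ; _≤_)
open import Data.List using (List)
open import Data.Product using (∃-syntax)

open import Data.Nat using (zero; suc; _+_; _∸_; _<_; _≡ᵇ_; _⊓_; _⊔_; z≤n; s≤s)
import Data.Nat.Properties as ℕ
open import Data.Nat.Induction using (<-rec)
open import Data.Integer as ℤ using (ℤ; +_; -[1+_])
import Data.Integer.Properties as ℤₚ
open import Data.Integer.Tactic.RingSolver using (solve-∀)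
open import Data.Bool using (Bool; true; false; T; _∧_; if_then_else_)
open import Data.Bool.Properties using (T-∧)
open import Data.List
  using ([]; _∷_; [_]; _++_; map; concatMap; filter; filterᵇ; foldr; length; upTo; applyUpTo; reverse; replicate; take)
import Data.List.Properties as List
open import Data.List.Membership.Propositional using (_∈_)
open import Data.List.Membership.Propositional.Properties
open import Data.List.Relation.Unary.All as All using (All; []; _∷_)
import Data.List.Relation.Unary.All.Properties as All
open import Data.List.Relation.Unary.AllPairs using (AllPairs; []; _∷_)
import Data.List.Relation.Unary.AllPairs.Properties as AllPairs
open import Data.List.Relation.Unary.Any using (here; there)
open import Data.Product using (_×_; _,_; proj₁; proj₂)
open import Data.Sum using (_⊎_; inj₁; inj₂)
open import Data.Empty using (⊥)
open import Function using (id; _∘_)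
open import Function.Bundles using (Equivalence)
open import Relation.Nullary using (Dec; yes; no; ¬_; contradiction)
open Relation.Nullary.Dec using (proof)
open import Relation.Nullary.Decidable using (⌊_⌋; toWitness; fromWitness; T?)
open import Relation.Nullary.Reflects using (Reflects; ofʸ; ofⁿ; _×-reflects_)
open import Relation.Unary using (Decidable)
open import Relation.Binary.Bundles using (Setoid)
open import Relation.Binary.PropositionalEquality hiding ([_])
import Relation.Binary.Reasoning.Setoid as SetoidReasoning

module LinearCombinations where
  open ≡-Reasoning

  matches : ℕ → List ℕ → ℕ → List ℕ → Bool
  matches e ν e′ μ = (e ≡ᵇ e′) ∧ ⌊ List.≡-dec ℕ._≟_ ν μ ⌋

  isYes-reflects : ∀ {A : Set} (a? : Dec A) → Reflects A ⌊ a? ⌋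
  isYes-reflects (yes a) = ofʸ a
  isYes-reflects (no ¬a) = ofⁿ ¬a

  matches-reflects : ∀ e ν e′ μ → Reflects ((e ≡ e′) × (ν ≡ μ)) (matches e ν e′ μ)
  matches-reflects e ν e′ μ = proof (e ℕ.≟ e′) ×-reflects isYes-reflects (List.≡-dec ℕ._≟_ ν μ)

  pairing : (ℕ → List ℕ → ℤ) → LC → ℤ
  pairing K []                = + 0
  pairing K ((c , e , μ) ∷ L) = c ℤ.* K e μ ℤ.+ pairing K L

  indicator : ℕ → List ℕ → ℕ → List ℕ → ℤ
  indicator e ν e′ μ = if matches e ν e′ μ then + 1 else + 0

  coeff≡pairing : ∀ e ν L → coeff e ν L ≡ pairing (indicator e ν) L
  coeff≡pairing e ν [] = refl
  coeff≡pairing e ν ((c , e′ , μ) ∷ L) with matches e ν e′ μ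
  ... | true  = cong₂ ℤ._+_ (sym (ℤₚ.*-identityʳ c)) (coeff≡pairing e ν L)
  ... | false = cong₂ ℤ._+_ (sym (ℤₚ.*-zeroʳ c)) (coeff≡pairing e ν L)

  pairing-++ : ∀ K L L′ → pairing K (L ++ L′) ≡ pairing K L ℤ.+ pairing K L′
  pairing-++ K [] L′ = sym (ℤₚ.+-identityˡ _)
  pairing-++ K ((c , e , μ) ∷ L) L′ =
    trans (cong (ℤ._+_ (c ℤ.* K e μ)) (pairing-++ K L L′)) (sym (ℤₚ.+-assoc (c ℤ.* K e μ) _ _))

  pairing-congˡ : ∀ {K K′} → (∀ e μ → K e μ ≡ K′ e μ) → ∀ L → pairing K L ≡ pairing K′ L
  pairing-congˡ K≡K′ [] = refl
  pairing-congˡ K≡K′ ((c , e , μ) ∷ L) = cong₂ (λ k p → c ℤ.* k ℤ.+ p) (K≡K′ e μ) (pairing-congˡ K≡K′ L)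

  pairing-+ˡ : ∀ K K′ L → pairing (λ e μ → K e μ ℤ.+ K′ e μ) L ≡ pairing K L ℤ.+ pairing K′ L
  pairing-+ˡ K K′ [] = refl
  pairing-+ˡ K K′ ((c , e , μ) ∷ L) rewrite pairing-+ˡ K K′ L =
    lemma c (K e μ) (K′ e μ) (pairing K L) (pairing K′ L)
    where
    lemma : ∀ c a b x y → c ℤ.* (a ℤ.+ b) ℤ.+ (x ℤ.+ y) ≡ (c ℤ.* a ℤ.+ x) ℤ.+ (c ℤ.* b ℤ.+ y)
    lemma = solve-∀

  pairing-zeroˡ : ∀ L → pairing (λ _ _ → + 0) L ≡ + 0
  pairing-zeroˡ [] = refl
  pairing-zeroˡ ((c , e , μ) ∷ L) rewrite pairing-zeroˡ L | ℤₚ.*-zeroʳ c = refl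

  negTerm : Term → Term
  negTerm (c , e , μ) = (ℤ.- c , e , μ)

  pairing-negTerm : ∀ K L → pairing K (map negTerm L) ≡ ℤ.- pairing K L
  pairing-negTerm K [] = refl
  pairing-negTerm K ((c , e , μ) ∷ L) rewrite pairing-negTerm K L = lemma c (K e μ) (pairing K L)
    where
    lemma : ∀ c k r → (ℤ.- c) ℤ.* k ℤ.+ ℤ.- r ≡ ℤ.- (c ℤ.* k ℤ.+ r)
    lemma = solve-∀

  shift : ℕ → (ℕ → List ℕ → ℤ) → ℕ → List ℕ → ℤ
  shift e K e′ ν = K (e + e′) ν

  -- The transpose of f acting on coefficient functionals.
  pullback : Op → (ℕ → List ℕ → ℤ) → ℕ → List ℕ → ℤ
  pullback f K e μ = pairing (shift e K) (f μ)

  scaleTerm : ℤ → ℕ → Term → Term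
  scaleTerm c e (c′ , e′ , ν) = (c ℤ.* c′ , e + e′ , ν)

  pairing-applyOp : ∀ K f L → pairing K (applyOp f L) ≡ pairing (pullback f K) L
  pairing-applyOp K f [] = refl
  pairing-applyOp K f ((c , e , μ) ∷ L) =
    trans (pairing-++ K (map _ (f μ)) (applyOp f L))
          (cong₂ ℤ._+_ (scaled (f μ)) (pairing-applyOp K f L))
    where
    scaled : ∀ X → pairing K (map (scaleTerm c e) X) ≡ c ℤ.* pairing (shift e K) X
    scaled [] = sym (ℤₚ.*-zeroʳ c)
    scaled ((c′ , e′ , ν) ∷ X) rewrite scaled X = lemma c c′ (K (e + e′) ν) (pairing (shift e K) X)
      where
      lemma : ∀ a b k r → a ℤ.* b ℤ.* k ℤ.+ a ℤ.* r ≡ a ℤ.* (b ℤ.* k ℤ.+ r)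
      lemma = solve-∀

  remove : ℕ → List ℕ → LC → LC
  remove e μ [] = []
  remove e μ ((c , e′ , μ′) ∷ L) =
    if matches e μ e′ μ′ then remove e μ L else (c , e′ , μ′) ∷ remove e μ L

  pairing-remove : ∀ K e μ L → pairing K L ≡ coeff e μ L ℤ.* K e μ ℤ.+ pairing K (remove e μ L)
  pairing-remove K e μ [] = refl
  pairing-remove K e μ ((c , e′ , μ′) ∷ L)
    with matches e μ e′ μ′ | matches-reflects e μ e′ μ′
  ... | true | ofʸ (refl , refl) rewrite pairing-remove K e μ L =
    lemma c (coeff e μ L) (K e μ) (pairing K (remove e μ L))
    where
    lemma : ∀ c a k r → c ℤ.* k ℤ.+ (a ℤ.* k ℤ.+ r) ≡ (c ℤ.+ a) ℤ.* k ℤ.+ r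
    lemma = solve-∀
  ... | false | _ rewrite pairing-remove K e μ L =
    lemma c (coeff e μ L) (K e μ) (K e′ μ′) (pairing K (remove e μ L))
    where
    lemma : ∀ c a k k′ r → c ℤ.* k′ ℤ.+ (a ℤ.* k ℤ.+ r) ≡ (+ 0 ℤ.+ a) ℤ.* k ℤ.+ (c ℤ.* k′ ℤ.+ r)
    lemma = solve-∀

  coeff-remove-self : ∀ e μ L → coeff e μ (remove e μ L) ≡ + 0
  coeff-remove-self e μ [] = refl
  coeff-remove-self e μ ((c , e′ , μ′) ∷ L) with matches e μ e′ μ′ in eq
  ... | true  = coeff-remove-self e μ L
  ... | false rewrite eq = trans (ℤₚ.+-identityˡ _) (coeff-remove-self e μ L)

  coeff-remove-other : ∀ e′ ν e μ L → ¬ ((e′ ≡ e) × (ν ≡ μ)) → coeff e′ ν (remove e μ L) ≡ coeff e′ ν L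
  coeff-remove-other e′ ν e μ [] _ = refl
  coeff-remove-other e′ ν e μ ((c , e″ , μ″) ∷ L) other
    with matches e μ e″ μ″ | matches-reflects e μ e″ μ″
  ... | false | _ = cong (ℤ._+_ (if matches e′ ν e″ μ″ then c else + 0)) (coeff-remove-other e′ ν e μ L other)
  ... | true | ofʸ (refl , refl) with matches e′ ν e μ | matches-reflects e′ ν e μ
  ...   | true  | ofʸ same = contradiction same other
  ...   | false | _       = trans (coeff-remove-other e′ ν e μ L other) (sym (ℤₚ.+-identityˡ _))

  length-remove : ∀ e μ L → length (remove e μ L) ≤ length L
  length-remove e μ [] = z≤n
  length-remove e μ ((c , e′ , μ′) ∷ L) with matches e μ e′ μ′
  ... | true  = ℕ.m≤n⇒m≤1+n (length-remove e μ L)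
  ... | false = s≤s (length-remove e μ L)

  length-remove-head : ∀ c e μ L → length (remove e μ ((c , e , μ) ∷ L)) ≤ length L
  length-remove-head c e μ L with matches e μ e μ | matches-reflects e μ e μ
  ... | true  | _          = length-remove e μ L
  ... | false | ofⁿ ¬same = contradiction (refl , refl) ¬same

  remove-vanishing : ∀ e μ L → (∀ e′ ν → coeff e′ ν L ≡ + 0) → ∀ e′ ν → coeff e′ ν (remove e μ L) ≡ + 0
  remove-vanishing e μ L vanishes e′ ν with e′ ℕ.≟ e | List.≡-dec ℕ._≟_ ν μ
  ... | yes refl | yes refl = coeff-remove-self e μ L
  ... | yes _    | no ν≢μ  = trans (coeff-remove-other e′ ν e μ L (ν≢μ ∘ proj₂)) (vanishes e′ ν)
  ... | no e′≢e  | _       = trans (coeff-remove-other e′ ν e μ L (e′≢e ∘ proj₁)) (vanishes e′ ν)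

  -- Induction on the length: removing the monomial of the head term shortens L.
  pairing-vanishing : ∀ K L → (∀ e ν → coeff e ν L ≡ + 0) → pairing K L ≡ + 0
  pairing-vanishing K L = go (length L) L ℕ.≤-refl
    where
    go : ∀ m L → length L ≤ m → (∀ e ν → coeff e ν L ≡ + 0) → pairing K L ≡ + 0
    go _ [] _ _ = refl
    go (suc m) L@((c , e , μ) ∷ L₀) (s≤s len) vanishes = begin
      pairing K L                                          ≡⟨ pairing-remove K e μ L ⟩
      coeff e μ L ℤ.* K e μ ℤ.+ pairing K (remove e μ L)   ≡⟨ cong₂ (λ a r → a ℤ.* K e μ ℤ.+ r) (vanishes e μ) rest ⟩
      + 0                                                  ∎
      where
      rest : pairing K (remove e μ L) ≡ + 0
      rest = go m (remove e μ L) (ℕ.≤-trans (length-remove-head c e μ L₀) len) (remove-vanishing e μ L vanishes)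

  coeff-++ : ∀ e ν L L′ → coeff e ν (L ++ L′) ≡ coeff e ν L ℤ.+ coeff e ν L′
  coeff-++ e ν L L′ = begin
    coeff e ν (L ++ L′)                                        ≡⟨ coeff≡pairing e ν (L ++ L′) ⟩
    pairing (indicator e ν) (L ++ L′)                          ≡⟨ pairing-++ _ L L′ ⟩
    pairing (indicator e ν) L ℤ.+ pairing (indicator e ν) L′
      ≡⟨ cong₂ ℤ._+_ (coeff≡pairing e ν L) (coeff≡pairing e ν L′) ⟨
    coeff e ν L ℤ.+ coeff e ν L′                               ∎

  coeff-negTerm : ∀ e ν L → coeff e ν (map negTerm L) ≡ ℤ.- coeff e ν L
  coeff-negTerm e ν L = begin
    coeff e ν (map negTerm L)               ≡⟨ coeff≡pairing e ν (map negTerm L) ⟩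
    pairing (indicator e ν) (map negTerm L) ≡⟨ pairing-negTerm _ L ⟩
    ℤ.- pairing (indicator e ν) L           ≡⟨ cong ℤ.-_ (sym (coeff≡pairing e ν L)) ⟩
    ℤ.- coeff e ν L                         ∎

  -- L - L′ has vanishing coefficients.
  pairing-resp-≈ : ∀ K {L L′} → L ≈ L′ → pairing K L ≡ pairing K L′
  pairing-resp-≈ K {L} {L′} L≈L′ = ℤₚ.i-j≡0⇒i≡j _ _ (begin
    pairing K L ℤ.- pairing K L′                ≡⟨ cong (ℤ._+_ (pairing K L)) (sym (pairing-negTerm K L′)) ⟩
    pairing K L ℤ.+ pairing K (map negTerm L′)  ≡⟨ sym (pairing-++ K L (map negTerm L′)) ⟩
    pairing K (L ++ map negTerm L′)             ≡⟨ pairing-vanishing K (L ++ map negTerm L′) difference-vanishes ⟩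
    + 0                                         ∎)
    where
    difference-vanishes : ∀ e ν → coeff e ν (L ++ map negTerm L′) ≡ + 0
    difference-vanishes e ν = begin
      coeff e ν (L ++ map negTerm L′)               ≡⟨ coeff-++ e ν L (map negTerm L′) ⟩
      coeff e ν L ℤ.+ coeff e ν (map negTerm L′)    ≡⟨ cong₂ (λ a b → a ℤ.+ b) (L≈L′ e ν) (coeff-negTerm e ν L′) ⟩
      coeff e ν L′ ℤ.- coeff e ν L′                 ≡⟨ ℤₚ.+-inverseʳ (coeff e ν L′) ⟩
      + 0                                           ∎

open LinearCombinations

module OperatorLaws where
  open ≡-Reasoning

  infix 4 _≋_
  record _≋_ (f g : Op) : Set where
    constructor mk≋
    field app-≈ : ∀ μ → f μ ≈ g μ
  open _≋_ public

  ≋-refl : ∀ {f} → f ≋ f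
  ≋-refl = mk≋ λ _ _ _ → refl

  ≋-sym : ∀ {f g} → f ≋ g → g ≋ f
  ≋-sym f≋g = mk≋ λ μ e ν → sym (app-≈ f≋g μ e ν)

  ≋-trans : ∀ {f g h} → f ≋ g → g ≋ h → f ≋ h
  ≋-trans f≋g g≋h = mk≋ λ μ e ν → trans (app-≈ f≋g μ e ν) (app-≈ g≋h μ e ν)

  ≋-reflexive : ∀ {f g} → f ≡ g → f ≋ g
  ≋-reflexive refl = ≋-refl

  ≋-setoid : Setoid _ _
  ≋-setoid = record
    { Carrier = Op ; _≈_ = _≋_
    ; isEquivalence = record { refl = ≋-refl ; sym = ≋-sym ; trans = ≋-trans } }

  ≋-by-pairing : ∀ {f g} → (∀ K μ → pairing K (f μ) ≡ pairing K (g μ)) → f ≋ g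
  ≋-by-pairing {f} {g} same = mk≋ λ μ e ν →
    trans (coeff≡pairing e ν (f μ)) (trans (same (indicator e ν) μ) (sym (coeff≡pairing e ν (g μ))))

  pairing-resp-≋ : ∀ K {f g} → f ≋ g → ∀ μ → pairing K (f μ) ≡ pairing K (g μ)
  pairing-resp-≋ K {f} {g} f≋g μ = pairing-resp-≈ K {f μ} {g μ} (app-≈ f≋g μ)

  pullback-shift : ∀ f K e e′ ν → pullback f (shift e K) e′ ν ≡ pullback f K (e + e′) ν
  pullback-shift f K e e′ ν = pairing-congˡ (λ e″ ν′ → cong (λ x → K x ν′) (sym (ℕ.+-assoc e e′ e″))) (f ν)

  ∘-congʳ : ∀ f {g g′} → g ≋ g′ → (f ∘ₒ g) ≋ (f ∘ₒ g′)
  ∘-congʳ f {g} {g′} g≋g′ = ≋-by-pairing λ K μ →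
    trans (pairing-applyOp K f (g μ))
          (trans (pairing-resp-≋ (pullback f K) g≋g′ μ) (sym (pairing-applyOp K f (g′ μ))))

  ∘-congˡ : ∀ {f f′} g → f ≋ f′ → (f ∘ₒ g) ≋ (f′ ∘ₒ g)
  ∘-congˡ {f} {f′} g f≋f′ = ≋-by-pairing λ K μ →
    trans (pairing-applyOp K f (g μ))
          (trans (pairing-congˡ (λ e → pairing-resp-≋ (shift e K) f≋f′) (g μ))
                 (sym (pairing-applyOp K f′ (g μ))))

  ∘-cong : ∀ {f f′ g g′} → f ≋ f′ → g ≋ g′ → (f ∘ₒ g) ≋ (f′ ∘ₒ g′)
  ∘-cong {f′ = f′} {g = g} f≋f′ g≋g′ = ≋-trans (∘-congˡ g f≋f′) (∘-congʳ f′ g≋g′)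

  ∘-assoc : ∀ f g h → ((f ∘ₒ g) ∘ₒ h) ≋ (f ∘ₒ (g ∘ₒ h))
  ∘-assoc f g h = ≋-by-pairing λ K μ → begin
    pairing K (applyOp (f ∘ₒ g) (h μ))               ≡⟨ pairing-applyOp K (f ∘ₒ g) (h μ) ⟩
    pairing (pullback (f ∘ₒ g) K) (h μ)
      ≡⟨ pairing-congˡ (λ e μ′ → pairing-applyOp (shift e K) f (g μ′)) (h μ) ⟩
    pairing (λ e μ′ → pairing (pullback f (shift e K)) (g μ′)) (h μ)
      ≡⟨ pairing-congˡ (λ e μ′ → pairing-congˡ (pullback-shift f K e) (g μ′)) (h μ) ⟩
    pairing (pullback g (pullback f K)) (h μ)        ≡⟨ sym (pairing-applyOp (pullback f K) g (h μ)) ⟩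
    pairing (pullback f K) (applyOp g (h μ))         ≡⟨ sym (pairing-applyOp K f (applyOp g (h μ))) ⟩
    pairing K (applyOp f (applyOp g (h μ)))          ∎

  +-cong : ∀ {f f′ g g′} → f ≋ f′ → g ≋ g′ → (f +ₒ g) ≋ (f′ +ₒ g′)
  +-cong {f} {f′} {g} {g′} f≋f′ g≋g′ = ≋-by-pairing λ K μ → begin
    pairing K (f μ ++ g μ)                ≡⟨ pairing-++ K (f μ) (g μ) ⟩
    pairing K (f μ) ℤ.+ pairing K (g μ)   ≡⟨ cong₂ ℤ._+_ (pairing-resp-≋ K f≋f′ μ) (pairing-resp-≋ K g≋g′ μ) ⟩
    pairing K (f′ μ) ℤ.+ pairing K (g′ μ) ≡⟨ pairing-++ K (f′ μ) (g′ μ) ⟨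
    pairing K (f′ μ ++ g′ μ)              ∎

  ∘-distribˡ : ∀ f g h → (f ∘ₒ (g +ₒ h)) ≋ ((f ∘ₒ g) +ₒ (f ∘ₒ h))
  ∘-distribˡ f g h = ≋-by-pairing λ K μ → begin
    pairing K (applyOp f (g μ ++ h μ))      ≡⟨ pairing-applyOp K f (g μ ++ h μ) ⟩
    pairing (pullback f K) (g μ ++ h μ)     ≡⟨ pairing-++ (pullback f K) (g μ) (h μ) ⟩
    pairing (pullback f K) (g μ) ℤ.+ pairing (pullback f K) (h μ)
      ≡⟨ sym (cong₂ ℤ._+_ (pairing-applyOp K f (g μ)) (pairing-applyOp K f (h μ))) ⟩
    pairing K (applyOp f (g μ)) ℤ.+ pairing K (applyOp f (h μ))
      ≡⟨ sym (pairing-++ K (applyOp f (g μ)) (applyOp f (h μ))) ⟩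
    pairing K (applyOp f (g μ) ++ applyOp f (h μ)) ∎

  ∘-distribʳ : ∀ f g h → ((f +ₒ g) ∘ₒ h) ≋ ((f ∘ₒ h) +ₒ (g ∘ₒ h))
  ∘-distribʳ f g h = ≋-by-pairing λ K μ → begin
    pairing K (applyOp (f +ₒ g) (h μ))      ≡⟨ pairing-applyOp K (f +ₒ g) (h μ) ⟩
    pairing (pullback (f +ₒ g) K) (h μ)     ≡⟨ pairing-congˡ (λ e μ′ → pairing-++ (shift e K) (f μ′) (g μ′)) (h μ) ⟩
    pairing (λ e μ′ → pullback f K e μ′ ℤ.+ pullback g K e μ′) (h μ)
      ≡⟨ pairing-+ˡ (pullback f K) (pullback g K) (h μ) ⟩
    pairing (pullback f K) (h μ) ℤ.+ pairing (pullback g K) (h μ)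
      ≡⟨ sym (cong₂ ℤ._+_ (pairing-applyOp K f (h μ)) (pairing-applyOp K g (h μ))) ⟩
    pairing K (applyOp f (h μ)) ℤ.+ pairing K (applyOp g (h μ))
      ≡⟨ sym (pairing-++ K (applyOp f (h μ)) (applyOp g (h μ))) ⟩
    pairing K (applyOp f (h μ) ++ applyOp g (h μ)) ∎

  ∘-zeroˡ : ∀ g → (zeroOp ∘ₒ g) ≋ zeroOp
  ∘-zeroˡ g = ≋-by-pairing λ K μ → trans (pairing-applyOp K zeroOp (g μ)) (pairing-zeroˡ (g μ))

  ∘-zeroʳ : ∀ f → (f ∘ₒ zeroOp) ≋ zeroOp
  ∘-zeroʳ f = ≋-refl

  ∘-identityˡ : ∀ f → (idOp ∘ₒ f) ≋ f
  ∘-identityˡ f = ≋-by-pairing λ K μ → trans (pairing-applyOp K idOp (f μ))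
    (pairing-congˡ (λ e μ′ → trans (ℤₚ.+-identityʳ _) (trans (ℤₚ.*-identityˡ _)
      (cong (λ x → K x μ′) (ℕ.+-identityʳ e)))) (f μ))

  ∘-identityʳ : ∀ f → (f ∘ₒ idOp) ≋ f
  ∘-identityʳ f = ≋-by-pairing λ K μ → trans (pairing-applyOp K f (idOp μ))
    (trans (ℤₚ.+-identityʳ _) (ℤₚ.*-identityˡ _))

  +-comm : ∀ f g → (f +ₒ g) ≋ (g +ₒ f)
  +-comm f g = ≋-by-pairing λ K μ → trans (pairing-++ K (f μ) (g μ))
    (trans (ℤₚ.+-comm (pairing K (f μ)) _) (sym (pairing-++ K (g μ) (f μ))))

  +-assoc : ∀ f g h → ((f +ₒ g) +ₒ h) ≋ (f +ₒ (g +ₒ h))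
  +-assoc f g h = mk≋ λ μ e ν → cong (coeff e ν) (List.++-assoc (f μ) (g μ) (h μ))

  +-identityˡ : ∀ f → (zeroOp +ₒ f) ≋ f
  +-identityˡ f = ≋-refl

  +-identityʳ : ∀ f → (f +ₒ zeroOp) ≋ f
  +-identityʳ f = mk≋ λ μ e ν → cong (coeff e ν) (List.++-identityʳ (f μ))

  neg-cong : ∀ {f g} → f ≋ g → negOp f ≋ negOp g
  neg-cong {f} {g} f≋g = ≋-by-pairing λ K μ →
    trans (pairing-negTerm K (f μ)) (trans (cong ℤ.-_ (pairing-resp-≋ K f≋g μ)) (sym (pairing-negTerm K (g μ))))

  +-inverseʳ : ∀ f → (f +ₒ negOp f) ≋ zeroOp
  +-inverseʳ f = ≋-by-pairing λ K μ → trans (pairing-++ K (f μ) (negOp f μ))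
    (trans (cong (ℤ._+_ (pairing K (f μ))) (pairing-negTerm K (f μ))) (ℤₚ.+-inverseʳ (pairing K (f μ))))

  neg-involutive : ∀ f → negOp (negOp f) ≋ f
  neg-involutive f = ≋-by-pairing λ K μ → trans (pairing-negTerm K (negOp f μ))
    (trans (cong ℤ.-_ (pairing-negTerm K (f μ))) (ℤₚ.neg-involutive _))

  neg-distrib-+ : ∀ f g → negOp (f +ₒ g) ≋ (negOp f +ₒ negOp g)
  neg-distrib-+ f g = mk≋ λ μ e ν → cong (coeff e ν) (List.map-++ negTerm (f μ) (g μ))

  neg-zero : negOp zeroOp ≋ zeroOp
  neg-zero = ≋-refl

open OperatorLaws

module FiniteSums where
  open SetoidReasoning ≋-setoid

  ∑ : {A : Set} → List A → (A → Op) → Op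
  ∑ L f = sumOps (map f L)

  syntax ∑ L (λ x → f) = ∑[ x ∈ L ] f

  when : Bool → Op → Op
  when p f = if p then f else zeroOp

  module _ {A : Set} where

    ∑-cong : ∀ (L : List A) {f g} → (∀ x → f x ≋ g x) → ∑ L f ≋ ∑ L g
    ∑-cong []      f≋g = ≋-refl
    ∑-cong (x ∷ L) f≋g = +-cong (f≋g x) (∑-cong L f≋g)

    ∑-cong-All : ∀ {L : List A} {f g} → All (λ x → f x ≋ g x) L → ∑ L f ≋ ∑ L g
    ∑-cong-All []           = ≋-refl
    ∑-cong-All (f≋g ∷ f≋gs) = +-cong f≋g (∑-cong-All f≋gs)

    ∑-zero-All : ∀ {L : List A} {f} → All (λ x → f x ≋ zeroOp) L → ∑ L f ≋ zeroOp
    ∑-zero-All []         = ≋-refl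
    ∑-zero-All (f≋0 ∷ f≋0s) = ≋-trans (+-cong f≋0 (∑-zero-All f≋0s)) (+-identityˡ zeroOp)

    ∑-zero : ∀ (L : List A) → ∑ L (λ _ → zeroOp) ≋ zeroOp
    ∑-zero []      = ≋-refl
    ∑-zero (x ∷ L) = ∑-zero L

    ∑-++ : ∀ (L L′ : List A) f → ∑ (L ++ L′) f ≋ (∑ L f +ₒ ∑ L′ f)
    ∑-++ []      L′ f = ≋-sym (+-identityˡ _)
    ∑-++ (x ∷ L) L′ f = begin
      f x +ₒ ∑ (L ++ L′) f        ≈⟨ +-cong (≋-refl {f x}) (∑-++ L L′ f) ⟩
      f x +ₒ (∑ L f +ₒ ∑ L′ f)    ≈⟨ +-assoc (f x) (∑ L f) (∑ L′ f) ⟨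
      (f x +ₒ ∑ L f) +ₒ ∑ L′ f    ∎

    ∑-+ : ∀ (L : List A) f g → ∑[ x ∈ L ] (f x +ₒ g x) ≋ (∑ L f +ₒ ∑ L g)
    ∑-+ []      f g = ≋-sym (+-identityˡ _)
    ∑-+ (x ∷ L) f g = begin
      (f x +ₒ g x) +ₒ (∑[ y ∈ L ] (f y +ₒ g y)) ≈⟨ +-cong ≋-refl (∑-+ L f g) ⟩
      (f x +ₒ g x) +ₒ (∑ L f +ₒ ∑ L g)          ≈⟨ +-assoc (f x) (g x) _ ⟩
      f x +ₒ (g x +ₒ (∑ L f +ₒ ∑ L g))          ≈⟨ +-cong (≋-refl {f x}) (+-assoc (g x) (∑ L f) (∑ L g)) ⟨
      f x +ₒ ((g x +ₒ ∑ L f) +ₒ ∑ L g)          ≈⟨ +-cong (≋-refl {f x}) (+-cong (+-comm (g x) (∑ L f)) ≋-refl) ⟩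
      f x +ₒ ((∑ L f +ₒ g x) +ₒ ∑ L g)          ≈⟨ +-cong (≋-refl {f x}) (+-assoc (∑ L f) (g x) (∑ L g)) ⟩
      f x +ₒ (∑ L f +ₒ (g x +ₒ ∑ L g))          ≈⟨ +-assoc (f x) (∑ L f) _ ⟨
      (f x +ₒ ∑ L f) +ₒ (g x +ₒ ∑ L g)          ∎

    ∑-split : ∀ (L : List A) {F f g} → (∀ x → F x ≋ (f x +ₒ g x)) → ∑ L F ≋ (∑ L f +ₒ ∑ L g)
    ∑-split L {f = f} {g} F≋f+g = ≋-trans (∑-cong L F≋f+g) (∑-+ L f g)

    ∑-neg : ∀ (L : List A) f → ∑[ x ∈ L ] negOp (f x) ≋ negOp (∑ L f)
    ∑-neg []      f = ≋-sym neg-zero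
    ∑-neg (x ∷ L) f = ≋-trans (+-cong (≋-refl {negOp (f x)}) (∑-neg L f)) (≋-sym (neg-distrib-+ (f x) (∑ L f)))

    ∑-∘ʳ : ∀ (L : List A) f g → (∑ L f ∘ₒ g) ≋ ∑[ x ∈ L ] (f x ∘ₒ g)
    ∑-∘ʳ []      f g = ∘-zeroˡ g
    ∑-∘ʳ (x ∷ L) f g = ≋-trans (∘-distribʳ (f x) (∑ L f) g) (+-cong (≋-refl {f x ∘ₒ g}) (∑-∘ʳ L f g))

    ∑-∘ˡ : ∀ (L : List A) f g → (g ∘ₒ ∑ L f) ≋ ∑[ x ∈ L ] (g ∘ₒ f x)
    ∑-∘ˡ []      f g = ∘-zeroʳ g
    ∑-∘ˡ (x ∷ L) f g = ≋-trans (∘-distribˡ g (f x) (∑ L f)) (+-cong (≋-refl {g ∘ₒ f x}) (∑-∘ˡ L f g))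

    ∑-filterᵇ : ∀ (L : List A) p f → ∑ (filterᵇ p L) f ≋ ∑[ x ∈ L ] when (p x) (f x)
    ∑-filterᵇ []      p f = ≋-refl
    ∑-filterᵇ (x ∷ L) p f with p x
    ... | true  = +-cong (≋-refl {f x}) (∑-filterᵇ L p f)
    ... | false = ∑-filterᵇ L p f

    ∑-filter : ∀ {P : A → Set} (P? : Decidable P) L f → ∑ (filter P? L) f ≋ ∑[ x ∈ L ] when ⌊ P? x ⌋ (f x)
    ∑-filter P? []      f = ≋-refl
    ∑-filter P? (x ∷ L) f with P? x
    ... | yes _ = +-cong (≋-refl {f x}) (∑-filter P? L f)
    ... | no _  = ∑-filter P? L f

    ∑-[_] : ∀ (x : A) f → ∑ [ x ] f ≋ f x
    ∑-[ x ] f = +-identityʳ (f x)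

    when-∑ : ∀ p (L : List A) f → when p (∑ L f) ≋ ∑[ x ∈ L ] when p (f x)
    when-∑ true  L f = ≋-refl
    when-∑ false L f = ≋-sym (∑-zero L)

  module _ {A B : Set} where

    ∑-map : ∀ (L : List A) (g : A → B) f → ∑ (map g L) f ≡ ∑[ x ∈ L ] f (g x)
    ∑-map L g f = cong sumOps (sym (List.map-∘ L))

    ∑-concatMap : ∀ (L : List A) (g : A → List B) f → ∑ (concatMap g L) f ≋ ∑[ x ∈ L ] ∑ (g x) f
    ∑-concatMap []      g f = ≋-refl
    ∑-concatMap (x ∷ L) g f = ≋-trans (∑-++ (g x) (concatMap g L) f) (+-cong (≋-refl {∑ (g x) f}) (∑-concatMap L g f))

    ∑-comm : ∀ (L : List A) (M : List B) (f : A → B → Op) →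
             ∑[ a ∈ L ] ∑[ b ∈ M ] f a b ≋ ∑[ b ∈ M ] ∑[ a ∈ L ] f a b
    ∑-comm []      M f = ≋-sym (∑-zero M)
    ∑-comm (a ∷ L) M f = begin
      ∑ M (f a) +ₒ (∑[ a′ ∈ L ] ∑[ b ∈ M ] f a′ b) ≈⟨ +-cong (≋-refl {∑ M (f a)}) (∑-comm L M f) ⟩
      ∑ M (f a) +ₒ (∑[ b ∈ M ] ∑[ a′ ∈ L ] f a′ b) ≈⟨ ≋-sym (∑-+ M (f a) (λ b → ∑[ a′ ∈ L ] f a′ b)) ⟩
      ∑[ b ∈ M ] ∑[ a′ ∈ a ∷ L ] f a′ b            ∎

  ∑-∘-∑ : ∀ {A B : Set} (L : List A) (M : List B) f g → (∑ L f ∘ₒ ∑ M g) ≋ ∑[ x ∈ L ] ∑[ y ∈ M ] (f x ∘ₒ g y)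
  ∑-∘-∑ L M f g = ≋-trans (∑-∘ʳ L f (∑ M g)) (∑-cong L (λ x → ∑-∘ˡ M g (f x)))

  when-∘ : ∀ p q f g → (when p f ∘ₒ when q g) ≋ when (p ∧ q) (f ∘ₒ g)
  when-∘ true  true  f g = ≋-refl
  when-∘ true  false f g = ∘-zeroʳ f
  when-∘ false q     f g = ∘-zeroˡ (when q g)

  when-cong : ∀ p {f g} → f ≋ g → when p f ≋ when p g
  when-cong true  f≋g = f≋g
  when-cong false f≋g = ≋-refl

  when-when : ∀ p q f → when p (when q f) ≋ when (p ∧ q) f
  when-when true  q f = ≋-refl
  when-when false q f = ≋-refl

open FiniteSums

module RibbonNilpotency where

  data Descending : ℕ → List ℕ → Set where
    []  : ∀ {k} → Descending k []
    _∷_ : ∀ {k x xs} → x ≤ k → Descending x xs → Descending k (x ∷ xs)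

  Antitone : List ℕ → Set
  Antitone μ = ∀ {r r′} → r ≤ r′ → rowLen μ r′ ≤ rowLen μ r

  rowLen-≤-bound : ∀ {k xs} → Descending k xs → ∀ r → rowLen xs r ≤ k
  rowLen-≤-bound []         r       = z≤n
  rowLen-≤-bound (x≤k ∷ xs) zero    = x≤k
  rowLen-≤-bound (x≤k ∷ xs) (suc r) = ℕ.≤-trans (rowLen-≤-bound xs r) x≤k

  Descending⇒Antitone : ∀ {k xs} → Descending k xs → Antitone xs
  Descending⇒Antitone []         _                 = z≤n
  Descending⇒Antitone (x≤k ∷ xs) {zero}  {zero}  _ = ℕ.≤-refl
  Descending⇒Antitone (x≤k ∷ xs) {zero}  {suc r′} _ = rowLen-≤-bound xs r′
  Descending⇒Antitone (x≤k ∷ xs) {suc r} {suc r′} (s≤s r≤r′) = Descending⇒Antitone xs r≤r′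

  m<o∸n⇒n+m<o : ∀ n o m → m < o ∸ n → n + m < o
  m<o∸n⇒n+m<o zero    o       m m<o   = m<o
  m<o∸n⇒n+m<o (suc n) (suc o) m m<o∸n = s≤s (m<o∸n⇒n+m<o n o m m<o∸n)

  ∈-range⁻ : ∀ {a b c} → c ∈ range a b → a ≤ c × c < b
  ∈-range⁻ {a} {b} c∈ with ∈-map⁻ (_+_ a) c∈
  ... | j , j∈ , refl = ℕ.m≤m+n a j , m<o∸n⇒n+m<o a b j (∈-upTo⁻ j∈)

  ∈-range⁺ : ∀ {a b c} → a ≤ c → c < b → c ∈ range a b
  ∈-range⁺ {a} {b} {c} a≤c c<b = subst (_∈ range a b) (ℕ.m+[n∸m]≡n a≤c)
    (∈-map⁺ (_+_ a) (∈-upTo⁺ (ℕ.∸-monoˡ-< c<b a≤c)))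

  partsF-descending : ∀ f m k → All (Descending k) (partsF f m k)
  partsF-descending zero m k with m ≡ᵇ 0
  ... | true  = [] ∷ []
  ... | false = []
  partsF-descending (suc f) m k with m ≡ᵇ 0
  ... | true  = [] ∷ []
  ... | false = All.concat⁺ (All.map⁺ (All.tabulate extend))
    where
    extend : ∀ {p} → p ∈ range 1 (suc (m ⊓ k)) → All (Descending k) (map (p ∷_) (partsF f (m ∸ p) p))
    extend {p} p∈ = All.map⁺ (All.map (p≤k ∷_) (partsF-descending f (m ∸ p) p))
      where
      p≤k : p ≤ k
      p≤k = ℕ.≤-trans (ℕ.≤-pred (proj₂ (∈-range⁻ p∈))) (ℕ.m⊓n≤n m k)

  partitionsOf-antitone : ∀ m → All Antitone (partitionsOf m)
  partitionsOf-antitone m = All.map Descending⇒Antitone (partsF-descending m m m)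

  rowBoxes : List ℕ → List ℕ → ℕ → List Box
  rowBoxes κ μ r = map (r ,_) (range (rowLen κ r) (rowLen μ r))

  ∈-skewBoxes⁻ : ∀ {κ μ r c} → (r , c) ∈ skewBoxes κ μ → r < length μ × rowLen κ r ≤ c × c < rowLen μ r
  ∈-skewBoxes⁻ {κ} {μ} b∈ with ∈-concat⁻′ (map (rowBoxes κ μ) (upTo (length μ))) b∈
  ... | row , b∈row , row∈ with ∈-map⁻ (rowBoxes κ μ) row∈
  ... | r , r∈ , refl with ∈-map⁻ (r ,_) b∈row
  ... | c , c∈ , refl = ∈-upTo⁻ r∈ , ∈-range⁻ c∈

  ∈-skewBoxes⁺ : ∀ {κ μ r c} → r < length μ → rowLen κ r ≤ c → c < rowLen μ r → (r , c) ∈ skewBoxes κ μ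
  ∈-skewBoxes⁺ {κ} {μ} {r} r<len κr≤c c<μr =
    ∈-concat⁺′ (∈-map⁺ (r ,_) (∈-range⁺ κr≤c c<μr)) (∈-map⁺ (rowBoxes κ μ) (∈-upTo⁺ r<len))

  rowLen-pos⇒< : ∀ xs r → 0 < rowLen xs r → r < length xs
  rowLen-pos⇒< (x ∷ xs) zero    _   = s≤s z≤n
  rowLen-pos⇒< (x ∷ xs) (suc r) pos = s≤s (rowLen-pos⇒< xs r pos)

  foldr-⊓-≤-init : ∀ r₀ xs → foldr _⊓_ r₀ xs ≤ r₀
  foldr-⊓-≤-init r₀ []       = ℕ.≤-refl
  foldr-⊓-≤-init r₀ (x ∷ xs) = ℕ.≤-trans (ℕ.m⊓n≤n x _) (foldr-⊓-≤-init r₀ xs)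

  foldr-⊓-≤ : ∀ r₀ {x} xs → x ∈ xs → foldr _⊓_ r₀ xs ≤ x
  foldr-⊓-≤ r₀ (x ∷ xs) (here refl) = ℕ.m⊓n≤m x _
  foldr-⊓-≤ r₀ (x ∷ xs) (there x∈) = ℕ.≤-trans (ℕ.m⊓n≤n x _) (foldr-⊓-≤ r₀ xs x∈)

  foldr-⊓-sel : ∀ r₀ xs → foldr _⊓_ r₀ xs ≡ r₀ ⊎ foldr _⊓_ r₀ xs ∈ xs
  foldr-⊓-sel r₀ []       = inj₁ refl
  foldr-⊓-sel r₀ (x ∷ xs) with ℕ.⊓-sel x (foldr _⊓_ r₀ xs)
  ... | inj₁ ≡x = inj₂ (here ≡x)
  ... | inj₂ ≡m rewrite ≡m with foldr-⊓-sel r₀ xs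
  ...   | inj₁ ≡r₀ = inj₁ ≡r₀
  ...   | inj₂ m∈  = inj₂ (there m∈)

  foldr-⊔-≥ : ∀ {y} ys → y ∈ ys → y ≤ foldr _⊔_ 0 ys
  foldr-⊔-≥ (y ∷ ys) (here refl) = ℕ.m≤m⊔n y _
  foldr-⊔-≥ (y ∷ ys) (there y∈) = ℕ.≤-trans (foldr-⊔-≥ ys y∈) (ℕ.m≤n⊔m y _)

  foldr-⊔-∈ : ∀ {y} ys → y ∈ ys → foldr _⊔_ 0 ys ∈ ys
  foldr-⊔-∈ (y ∷ [])      _ = here (ℕ.⊔-identityʳ y)
  foldr-⊔-∈ (y ∷ y′ ∷ ys) _
    with ℕ.⊔-sel y (foldr _⊔_ 0 (y′ ∷ ys)) | foldr-⊔-∈ (y′ ∷ ys) (here refl)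
  ... | inj₁ ≡y | _  = here ≡y
  ... | inj₂ ≡m | m∈ = there (subst (_∈ y′ ∷ ys) (sym ≡m) m∈)

  record IsTopRight (bs : List Box) (h : Box) : Set where
    field
      ∈-boxes   : h ∈ bs
      top       : ∀ {b} → b ∈ bs → proj₁ h ≤ proj₁ b
      rightmost : ∀ {b} → b ∈ bs → proj₁ b ≡ proj₁ h → proj₂ b ≤ proj₂ h
  open IsTopRight

  headOf-isTopRight : ∀ r₀ c₀ bs → IsTopRight ((r₀ , c₀) ∷ bs) (headOf ((r₀ , c₀) ∷ bs))
  headOf-isTopRight r₀ c₀ bs = record { ∈-boxes = head∈ ; top = top-≤ ; rightmost = right-≥ }
    where
    boxes = (r₀ , c₀) ∷ bs
    topRow = foldr _⊓_ r₀ (map proj₁ bs)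
    inTopRow : Box → Bool
    inTopRow b = proj₁ b ≡ᵇ topRow
    topRowBoxes = filterᵇ inTopRow boxes
    right = foldr _⊔_ 0 (map proj₂ topRowBoxes)

    top-≤ : ∀ {b} → b ∈ boxes → topRow ≤ proj₁ b
    top-≤ (here refl) = foldr-⊓-≤-init r₀ (map proj₁ bs)
    top-≤ (there b∈)  = foldr-⊓-≤ r₀ (map proj₁ bs) (∈-map⁺ proj₁ b∈)

    ∈-topRowBoxes : ∀ {b} → b ∈ boxes → proj₁ b ≡ topRow → b ∈ topRowBoxes
    ∈-topRowBoxes b∈ b-top = ∈-filter⁺ (T? ∘ inTopRow) b∈ (ℕ.≡⇒≡ᵇ _ _ b-top)

    right-≥ : ∀ {b} → b ∈ boxes → proj₁ b ≡ topRow → proj₂ b ≤ right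
    right-≥ b∈ b-top = foldr-⊔-≥ (map proj₂ topRowBoxes) (∈-map⁺ proj₂ (∈-topRowBoxes b∈ b-top))

    some-top : ∃[ b ] (b ∈ boxes × proj₁ b ≡ topRow)
    some-top with foldr-⊓-sel r₀ (map proj₁ bs)
    ... | inj₁ ≡r₀ = (r₀ , c₀) , here refl , sym ≡r₀
    ... | inj₂ m∈ with ∈-map⁻ proj₁ m∈
    ...   | b , b∈ , ≡b = b , there b∈ , sym ≡b

    head∈ : (topRow , right) ∈ boxes
    head∈ with some-top
    ... | b , b∈ , b-top
      with ∈-map⁻ proj₂ (foldr-⊔-∈ (map proj₂ topRowBoxes) (∈-map⁺ proj₂ (∈-topRowBoxes b∈ b-top)))
    ... | b′ , b′∈ , ≡right with ∈-filter⁻ (T? ∘ inTopRow) {xs = boxes} b′∈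
    ... | b′∈boxes , b′-top = subst (_∈ boxes) (cong₂ _,_ (ℕ.≡ᵇ⇒≡ _ _ b′-top) (sym ≡right)) b′∈boxes

  addsRibbon : ℕ → ℤ → List ℕ → List ℕ → Bool
  addsRibbon n i κ μ = isRibbon n κ μ ∧ ⌊ diag (headOf (skewBoxes κ μ)) ℤ.≟ i ⌋

  record HeadOn (i : ℤ) (κ μ : List ℕ) : Set where
    field
      topRight   : IsTopRight (skewBoxes κ μ) (headOf (skewBoxes κ μ))
      onDiagonal : diag (headOf (skewBoxes κ μ)) ≡ i

  addsRibbon⇒HeadOn : ∀ {n i κ μ} → 1 ≤ n → T (addsRibbon n i κ μ) → HeadOn i κ μ
  addsRibbon⇒HeadOn {n} {i} {κ} {μ} 1≤n adds with Equivalence.to (T-∧ {isRibbon n κ μ}) adds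
  ... | ribbon , onDiagonal with Equivalence.to (T-∧ {contained κ μ}) ribbon
  ... | _ , sizeAndShape with Equivalence.to (T-∧ {length (skewBoxes κ μ) ≡ᵇ n}) sizeAndShape
  ... | size≡n , _ = record
    { topRight = nonempty (skewBoxes κ μ) size≡n ; onDiagonal = toWitness onDiagonal }
    where
    nonempty : ∀ bs → T (length bs ≡ᵇ n) → IsTopRight bs (headOf bs)
    nonempty []             0≡n = contradiction (ℕ.≡ᵇ⇒≡ 0 n 0≡n) (ℕ.<⇒≢ 1≤n)
    nonempty ((r , c) ∷ bs) _   = headOf-isTopRight r c bs

  diag-injective : ∀ r c r′ c′ → diag (r , c) ≡ diag (r′ , c′) → c + r′ ≡ c′ + r
  diag-injective r c r′ c′ same = ℤₚ.+-injective (begin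
    + (c + r′)                           ≡⟨ ℤₚ.pos-+ c r′ ⟩
    + c ℤ.+ + r′                         ≡⟨ split (+ c) (+ r) (+ r′) ⟩
    (+ c ℤ.- + r) ℤ.+ (+ r ℤ.+ + r′)     ≡⟨ cong (ℤ._+ (+ r ℤ.+ + r′)) same ⟩
    (+ c′ ℤ.- + r′) ℤ.+ (+ r ℤ.+ + r′)   ≡⟨ merge (+ c′) (+ r) (+ r′) ⟩
    + c′ ℤ.+ + r                         ≡⟨ ℤₚ.pos-+ c′ r ⟨
    + (c′ + r)                           ∎)
    where
    open ≡-Reasoning
    split : ∀ a b d → a ℤ.+ d ≡ (a ℤ.- b) ℤ.+ (b ℤ.+ d)
    split = solve-∀
    merge : ∀ a b d → (a ℤ.- d) ℤ.+ (b ℤ.+ d) ≡ a ℤ.+ b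
    merge = solve-∀

  bounded-by-last : ∀ {lo c p} → lo ≤ c → c < p → (∀ {x} → lo ≤ x → x < p → x ≤ c) → p ≤ suc c
  bounded-by-last {p = suc p} lo≤c c<p below-c = s≤s (below-c (ℕ.≤-trans lo≤c (ℕ.≤-pred c<p)) ℕ.≤-refl)

  -- (r , c) is the last box of row r of μ, and (r′ , c′) a box of ν/μ on the same diagonal in the
  -- top row of ν/μ. If r′ ≤ r then c′ ≥ μ_r′ ≥ μ_r > c, off the diagonal; if r < r′ then c < c′,
  -- so (r , c + 1) is a box of ν/μ above row r′.
  stacked-on-diagonal : ∀ {μ ν r c r′ c′} → Antitone μ → Antitone ν →
    c < rowLen μ r → rowLen μ r ≤ suc c → rowLen μ r′ ≤ c′ → c′ < rowLen ν r′ →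
    (∀ {b} → b ∈ skewBoxes μ ν → r′ ≤ proj₁ b) → c + r′ ≡ c′ + r → ⊥
  stacked-on-diagonal {μ} {ν} {r} {c} {r′} {c′} μ-antitone ν-antitone c<μr μr≤1+c μr′≤c′ c′<νr′ r′-top same-diagonal
      with r′ ℕ.≤? r
  ... | yes r′≤r = ℕ.<-irrefl same-diagonal (ℕ.+-mono-<-≤ c<c′ r′≤r)
    where
    c<c′ : c < c′
    c<c′ = ℕ.<-≤-trans c<μr (ℕ.≤-trans (μ-antitone r′≤r) μr′≤c′)
  ... | no r′≰r = ℕ.<-irrefl refl (ℕ.≤-<-trans (r′-top box∈) r<r′)
    where
    r<r′ : r < r′
    r<r′ = ℕ.≰⇒> r′≰r
    c<c′ : c < c′
    c<c′ = ℕ.+-cancelʳ-< r c c′ (ℕ.<-≤-trans (ℕ.+-monoʳ-< c r<r′) (ℕ.≤-reflexive same-diagonal))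
    1+c<νr : suc c < rowLen ν r
    1+c<νr = ℕ.≤-<-trans c<c′ (ℕ.<-≤-trans c′<νr′ (ν-antitone (ℕ.<⇒≤ r<r′)))
    box∈ : (r , suc c) ∈ skewBoxes μ ν
    box∈ = ∈-skewBoxes⁺ {μ} {ν} (rowLen-pos⇒< ν r (ℕ.≤-<-trans z≤n 1+c<νr)) μr≤1+c 1+c<νr

  no-stacked-heads : ∀ {i κ μ ν} → Antitone μ → Antitone ν → HeadOn i κ μ → HeadOn i μ ν → ⊥
  no-stacked-heads {i} {κ} {μ} {ν} μ-antitone ν-antitone h₁ h₂ =
    let r<len , κr≤c , c<μr = ∈-skewBoxes⁻ {κ} {μ} (∈-boxes top₁)
        _ , μr′≤c′ , c′<νr′ = ∈-skewBoxes⁻ {μ} {ν} (∈-boxes top₂)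
        rightmost₁ = λ {x} κr≤x x<μr → rightmost top₁ (∈-skewBoxes⁺ {κ} {μ} {c = x} r<len κr≤x x<μr) refl
    in stacked-on-diagonal {μ} {ν} μ-antitone ν-antitone c<μr (bounded-by-last κr≤c c<μr rightmost₁)
         μr′≤c′ c′<νr′ (top top₂) same-diagonal
    where
    top₁ = HeadOn.topRight h₁
    top₂ = HeadOn.topRight h₂
    head₁ = headOf (skewBoxes κ μ)
    head₂ = headOf (skewBoxes μ ν)
    same-diagonal : proj₂ head₁ + proj₁ head₂ ≡ proj₂ head₂ + proj₁ head₁
    same-diagonal = diag-injective (proj₁ head₁) (proj₂ head₁) (proj₁ head₂) (proj₂ head₂)
      (trans (HeadOn.onDiagonal h₁) (sym (HeadOn.onDiagonal h₂)))

  concatMap-if-none : ∀ {A B : Set} (p : A → Bool) (t : A → B) {L} → All (λ x → ¬ T (p x)) L →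
                      concatMap (λ x → if p x then [ t x ] else []) L ≡ []
  concatMap-if-none p t []              = refl
  concatMap-if-none p t {x ∷ L} (¬px ∷ ¬ps) with p x
  ... | true  = contradiction _ ¬px
  ... | false = concatMap-if-none p t ¬ps

  applyOp-if-killed : ∀ f (p : List ℕ → Bool) (s : List ℕ → ℕ) {L} → All (λ x → T (p x) → f x ≡ []) L →
                      applyOp f (concatMap (λ x → if p x then [ (+ 1 , s x , x) ] else []) L) ≡ []
  applyOp-if-killed f p s []                = refl
  applyOp-if-killed f p s {x ∷ L} (kills ∷ killss) with p x
  ... | true  rewrite kills _ = applyOp-if-killed f p s killss
  ... | false = applyOp-if-killed f p s killss

  u-after-u : ∀ {n i κ μ} → 1 ≤ n → Antitone μ → T (addsRibbon n i κ μ) → u n i μ ≡ []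
  u-after-u {n} {i} {κ} {μ} 1≤n μ-antitone adds =
    concatMap-if-none (addsRibbon n i μ) (λ ν → (+ 1 , spin (skewBoxes μ ν) , ν))
      (All.map (λ {ν} → no-second {ν}) (partitionsOf-antitone (size μ + n)))
    where
    no-second : ∀ {ν} → Antitone ν → ¬ T (addsRibbon n i μ ν)
    no-second {ν} ν-antitone adds′ = no-stacked-heads μ-antitone ν-antitone
      (addsRibbon⇒HeadOn {n} {i} {κ} {μ} 1≤n adds) (addsRibbon⇒HeadOn {n} {i} {μ} {ν} 1≤n adds′)

  u∘u≋0 : ∀ {n} → 1 ≤ n → ∀ i → (u n i ∘ₒ u n i) ≋ zeroOp
  u∘u≋0 {n} 1≤n i = mk≋ λ κ e ν → cong (coeff e ν)
    (applyOp-if-killed (u n i) (addsRibbon n i κ) (λ μ → spin (skewBoxes κ μ))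
      (All.map (λ {μ} → killed κ {μ}) (partitionsOf-antitone (size κ + n))))
    where
    killed : ∀ κ {μ} → Antitone μ → T (addsRibbon n i κ μ) → u n i μ ≡ []
    killed κ {μ} μ-antitone = u-after-u {κ = κ} {μ = μ} 1≤n μ-antitone

open RibbonNilpotency using (u∘u≋0)

module IncreasingSequences where
  open SetoidReasoning ≋-setoid

  Sorted : List ℤ → Set
  Sorted = AllPairs ℤ._<_

  above : ℤ → List ℤ → Bool
  above z []      = true
  above z (y ∷ _) = ⌊ z ℤ.<? y ⌋

  strictInc-∷ : ∀ x t → strictInc (x ∷ t) ≡ above x t ∧ strictInc t
  strictInc-∷ x []      = refl
  strictInc-∷ x (y ∷ t) = refl

  greater : ℤ → List ℤ → List ℤ
  greater z = filter (z ℤ.<?_)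

  greater-greater : ∀ {z x} → z ℤ.< x → ∀ V → greater x (greater z V) ≡ greater x V
  greater-greater z<x [] = refl
  greater-greater {z} {x} z<x (v ∷ V) with z ℤ.<? v
  ... | yes _ with x ℤ.<? v
  ...   | yes _ = cong (v ∷_) (greater-greater z<x V)
  ...   | no _  = greater-greater z<x V
  greater-greater {z} {x} z<x (v ∷ V) | no z≮v with x ℤ.<? v
  ...   | yes x<v = contradiction (ℤₚ.<-trans z<x x<v) z≮v
  ...   | no _    = greater-greater z<x V

  ∑-listsOfLen-suc : ∀ k W (f : List ℤ → Op) → ∑ (listsOfLen (suc k) W) f ≋ ∑[ x ∈ W ] ∑[ t ∈ listsOfLen k W ] f (x ∷ t)
  ∑-listsOfLen-suc k W f = ≋-trans (∑-concatMap W (λ x → map (x ∷_) (listsOfLen k W)) f)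
    (∑-cong W (λ x → ≋-reflexive (∑-map (listsOfLen k W) (x ∷_) f)))

  ∑-incSeqs-suc : ∀ k {V} → Sorted V → (f : List ℤ → Op) →
    ∑ (incSeqs (suc k) V) f ≋ ∑[ x ∈ V ] ∑[ t ∈ incSeqs k (greater x V) ] f (x ∷ t)
  ∑-incSeqs-suc k [] f = ≋-refl
  ∑-incSeqs-suc k {w ∷ V} (w<V ∷ V↑) f = begin
    ∑ (map (w ∷_) (incSeqs k V) ++ incSeqs (suc k) V) f
      ≈⟨ ∑-++ (map (w ∷_) (incSeqs k V)) (incSeqs (suc k) V) f ⟩
    ∑ (map (w ∷_) (incSeqs k V)) f +ₒ ∑ (incSeqs (suc k) V) f
      ≈⟨ +-cong (≋-reflexive (trans (∑-map (incSeqs k V) (w ∷_) f) (tails-≡ greater-w))) (∑-incSeqs-suc k V↑ f) ⟩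
    tails w +ₒ (∑[ x ∈ V ] ∑[ t ∈ incSeqs k (greater x V) ] f (x ∷ t))
      ≈⟨ +-cong (≋-refl {tails w}) (∑-cong-All (All.map (λ w<x → ≋-reflexive (tails-≡ (greater-skip w<x))) w<V)) ⟩
    ∑ (w ∷ V) tails ∎
    where
    tails : ℤ → Op
    tails x = ∑[ t ∈ incSeqs k (greater x (w ∷ V)) ] f (x ∷ t)
    tails-≡ : ∀ {x U U′} → U ≡ U′ → ∑[ t ∈ incSeqs k U ] f (x ∷ t) ≡ ∑[ t ∈ incSeqs k U′ ] f (x ∷ t)
    tails-≡ refl = refl
    greater-w : V ≡ greater w (w ∷ V)
    greater-w = sym (trans (List.filter-reject (w ℤ.<?_) (ℤₚ.<-irrefl refl)) (List.filter-all (w ℤ.<?_) w<V))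
    greater-skip : ∀ {x} → w ℤ.< x → greater x V ≡ greater x (w ∷ V)
    greater-skip w<x = sym (List.filter-reject (_ ℤ.<?_) (ℤₚ.<-asym w<x))

  ∑-incSeqs-greater : ∀ k {V} → Sorted V → ∀ z (f : List ℤ → Op) →
    ∑ (incSeqs k (greater z V)) f ≋ ∑[ s ∈ listsOfLen k V ] when (above z s ∧ strictInc s) (f s)
  ∑-incSeqs-greater zero    V↑ z f = ≋-refl
  ∑-incSeqs-greater (suc k) {V} V↑ z f = begin
    ∑ (incSeqs (suc k) (greater z V)) f
      ≈⟨ ∑-incSeqs-suc k (AllPairs.filter⁺ (z ℤ.<?_) V↑) f ⟩
    ∑[ x ∈ greater z V ] ∑[ t ∈ incSeqs k (greater x (greater z V)) ] f (x ∷ t)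
      ≈⟨ ∑-cong-All (All.map (λ z<x → ≋-reflexive (cong (λ U → ∑[ t ∈ incSeqs k U ] f (_ ∷ t)) (greater-greater z<x V)))
                             (All.all-filter (z ℤ.<?_) V)) ⟩
    ∑[ x ∈ greater z V ] ∑[ t ∈ incSeqs k (greater x V) ] f (x ∷ t)
      ≈⟨ ∑-filter (z ℤ.<?_) V _ ⟩
    ∑[ x ∈ V ] when ⌊ z ℤ.<? x ⌋ (∑[ t ∈ incSeqs k (greater x V) ] f (x ∷ t))
      ≈⟨ ∑-cong V (λ x → when-cong ⌊ z ℤ.<? x ⌋ (∑-incSeqs-greater k V↑ x (λ t → f (x ∷ t)))) ⟩
    ∑[ x ∈ V ] when ⌊ z ℤ.<? x ⌋ (∑[ t ∈ listsOfLen k V ] when (above x t ∧ strictInc t) (f (x ∷ t)))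
      ≈⟨ ∑-cong V (λ x → ≋-trans (when-∑ ⌊ z ℤ.<? x ⌋ (listsOfLen k V) _) (∑-cong (listsOfLen k V) (λ t →
           ≋-trans (when-when ⌊ z ℤ.<? x ⌋ _ (f (x ∷ t)))
                   (≋-reflexive (cong (λ b → when (⌊ z ℤ.<? x ⌋ ∧ b) (f (x ∷ t))) (sym (strictInc-∷ x t))))))) ⟩
    ∑[ x ∈ V ] ∑[ t ∈ listsOfLen k V ] when (above z (x ∷ t) ∧ strictInc (x ∷ t)) (f (x ∷ t))
      ≈⟨ ≋-sym (∑-listsOfLen-suc k V (λ s → when (above z s ∧ strictInc s) (f s))) ⟩
    ∑[ s ∈ listsOfLen (suc k) V ] when (above z s ∧ strictInc s) (f s) ∎

  ∑-incSeqs : ∀ k {V} → Sorted V → (f : List ℤ → Op) →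
    ∑ (incSeqs k V) f ≋ ∑[ s ∈ listsOfLen k V ] when (strictInc s) (f s)
  ∑-incSeqs zero    V↑ f = ≋-refl
  ∑-incSeqs (suc k) {V} V↑ f = begin
    ∑ (incSeqs (suc k) V) f
      ≈⟨ ∑-incSeqs-suc k V↑ f ⟩
    ∑[ x ∈ V ] ∑[ t ∈ incSeqs k (greater x V) ] f (x ∷ t)
      ≈⟨ ∑-cong V (λ x → ∑-incSeqs-greater k V↑ x (λ t → f (x ∷ t))) ⟩
    ∑[ x ∈ V ] ∑[ t ∈ listsOfLen k V ] when (above x t ∧ strictInc t) (f (x ∷ t))
      ≈⟨ ∑-cong V (λ x → ∑-cong (listsOfLen k V) (λ t →
           ≋-reflexive (cong (λ b → when b (f (x ∷ t))) (sym (strictInc-∷ x t))))) ⟩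
    ∑[ x ∈ V ] ∑[ t ∈ listsOfLen k V ] when (strictInc (x ∷ t)) (f (x ∷ t))
      ≈⟨ ≋-sym (∑-listsOfLen-suc k V (λ s → when (strictInc s) (f s))) ⟩
    ∑[ s ∈ listsOfLen (suc k) V ] when (strictInc s) (f s) ∎

  window-sorted : ∀ N → Sorted (window N)
  window-sorted N = subst Sorted (sym (List.map-upTo (λ k → + k ℤ.- + N) (suc (N + N))))
    (AllPairs.applyUpTo⁺₁ (λ k → + k ℤ.- + N) (suc (N + N)) (λ i<j _ → ℤₚ.+-monoˡ-< (ℤ.- + N) (ℤ.+<+ i<j)))

open IncreasingSequences

word : (ℤ → Op) → List ℤ → Op
word v = foldr (λ i acc → v i ∘ₒ acc) idOp

reverse-∷-++ : ∀ {A : Set} (y : A) xs zs → reverse (y ∷ xs) ++ zs ≡ reverse xs ++ y ∷ zs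
reverse-∷-++ y xs zs = trans (sym (List.ʳ++-defn (y ∷ xs))) (List.ʳ++-defn xs)

-- The three cases x < y, y < x and x = y of the corner comparison in the Pieri rule.
when-trichotomy : ∀ a b p q {f g} → f ≋ g → (T p → ¬ T q) → (¬ T p → ¬ T q → f ≋ zeroOp) →
  when (a ∧ b) f ≋ (when (a ∧ (p ∧ b)) f +ₒ when ((q ∧ a) ∧ b) g)
when-trichotomy a     b     true  true  f≋g p⇒¬q _  = contradiction _ (p⇒¬q _)
when-trichotomy a     b     true  false f≋g _    _  = ≋-sym (+-identityʳ _)
when-trichotomy true  b     false true  f≋g _    _  = when-cong b f≋g
when-trichotomy false b     false true  f≋g _    _  = ≋-refl
when-trichotomy true  true  false false f≋g _ f≋0 = f≋0 (λ ()) (λ ())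
when-trichotomy true  false false false f≋g _ _   = ≋-refl
when-trichotomy false b     false false f≋g _ _   = ≋-refl

module Hooks (v : ℤ → Op) (v∘v≋0 : ∀ i → (v i ∘ₒ v i) ≋ zeroOp) {W : List ℤ} (W↑ : Sorted W) where
  open SetoidReasoning ≋-setoid

  ℒ : ℕ → List (List ℤ)
  ℒ k = listsOfLen k W

  complete : ℕ → Op
  complete k = ∑[ s ∈ incSeqs k W ] word v (reverse s)

  -- The fillings of the hook (1 + a , 1^b) with first row x ∷ r and first column x ∷ c.
  hookSum : ℕ → ℕ → Op
  hookSum a b = ∑[ x ∈ W ] ∑[ r ∈ ℒ a ] ∑[ c ∈ ℒ b ]
    when (strictInc (x ∷ r) ∧ strictInc (x ∷ c)) (word v (reverse (x ∷ r) ++ c))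

  word-++ : ∀ w w′ → word v (w ++ w′) ≋ (word v w ∘ₒ word v w′)
  word-++ []      w′ = ≋-sym (∘-identityˡ (word v w′))
  word-++ (x ∷ w) w′ = begin
    v x ∘ₒ word v (w ++ w′)          ≈⟨ ∘-congʳ (v x) (word-++ w w′) ⟩
    v x ∘ₒ (word v w ∘ₒ word v w′)   ≈⟨ ∘-assoc (v x) (word v w) (word v w′) ⟨
    (v x ∘ₒ word v w) ∘ₒ word v w′   ∎

  word-repeat : ∀ w x w′ → word v (w ++ x ∷ x ∷ w′) ≋ zeroOp
  word-repeat w x w′ = begin
    word v (w ++ x ∷ x ∷ w′)                 ≈⟨ word-++ w (x ∷ x ∷ w′) ⟩
    word v w ∘ₒ (v x ∘ₒ (v x ∘ₒ word v w′))  ≈⟨ ∘-congʳ (word v w) (∘-assoc (v x) (v x) (word v w′)) ⟨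
    word v w ∘ₒ ((v x ∘ₒ v x) ∘ₒ word v w′)  ≈⟨ ∘-congʳ (word v w) (∘-congˡ (word v w′) (v∘v≋0 x)) ⟩
    word v w ∘ₒ (zeroOp ∘ₒ word v w′)        ≈⟨ ∘-congʳ (word v w) (∘-zeroˡ (word v w′)) ⟩
    word v w ∘ₒ zeroOp                       ≈⟨ ∘-zeroʳ (word v w) ⟩
    zeroOp                                   ∎

  complete-suc : ∀ k → complete (suc k) ≋ ∑[ x ∈ W ] ∑[ r ∈ ℒ k ] when (strictInc (x ∷ r)) (word v (reverse (x ∷ r)))
  complete-suc k = ≋-trans (∑-incSeqs (suc k) W↑ (word v ∘ reverse))
                    (∑-listsOfLen-suc k W (λ s → when (strictInc s) (word v (reverse s))))

  complete≋hookSum-row : ∀ k → complete (suc k) ≋ hookSum k 0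
  complete≋hookSum-row k = ≋-trans (complete-suc k) (∑-cong W (λ x → ∑-cong (ℒ k) (λ r → ≋-sym (≋-trans
    (∑-[ [] ] (λ c → when (strictInc (x ∷ r) ∧ strictInc (x ∷ c)) (word v (reverse (x ∷ r) ++ c))))
    (≋-reflexive (cong₂ (λ b w → when b (word v w))
                        (∧-true (strictInc (x ∷ r))) (List.++-identityʳ (reverse (x ∷ r)))))))))
    where
    ∧-true : ∀ b → b ∧ true ≡ b
    ∧-true true  = refl
    ∧-true false = refl

  hookSum-column : ∀ l → hookSum 0 l ≋ ∑[ y ∈ W ] ∑[ c ∈ ℒ l ] when (strictInc (y ∷ c)) (word v (y ∷ c))
  hookSum-column l = ∑-cong W (λ y → ∑-[ [] ] (λ r → ∑[ c ∈ ℒ l ]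
    when (strictInc (y ∷ r) ∧ strictInc (y ∷ c)) (word v (reverse (y ∷ r) ++ c))))

  -- The product of the row word and the column word is a hook filling with corner x when x < y
  -- and with corner y when y < x, and it vanishes when x = y since v x ∘ v x = 0.
  split-corner : ∀ x r y c →
    when (strictInc (x ∷ r) ∧ strictInc (y ∷ c)) (word v (reverse (x ∷ r) ++ y ∷ c))
    ≋ (when (strictInc (x ∷ r) ∧ strictInc (x ∷ y ∷ c)) (word v (reverse (x ∷ r) ++ y ∷ c))
       +ₒ when (strictInc (y ∷ x ∷ r) ∧ strictInc (y ∷ c)) (word v (reverse (y ∷ x ∷ r) ++ c)))
  split-corner x r y c =
    when-trichotomy (strictInc (x ∷ r)) (strictInc (y ∷ c)) ⌊ x ℤ.<? y ⌋ ⌊ y ℤ.<? x ⌋ same-word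
      (λ x<y y<x → ℤₚ.<-asym (toWitness x<y) (toWitness y<x)) repeated
    where
    same-word : word v (reverse (x ∷ r) ++ y ∷ c) ≋ word v (reverse (y ∷ x ∷ r) ++ c)
    same-word = ≋-reflexive (cong (word v) (sym (reverse-∷-++ y (x ∷ r) c)))
    repeated : ¬ T ⌊ x ℤ.<? y ⌋ → ¬ T ⌊ y ℤ.<? x ⌋ → word v (reverse (x ∷ r) ++ y ∷ c) ≋ zeroOp
    repeated x≮y y≮x with ℤₚ.≤-antisym (ℤₚ.≮⇒≥ (y≮x ∘ fromWitness)) (ℤₚ.≮⇒≥ (x≮y ∘ fromWitness))
    ... | refl = ≋-trans
      (≋-reflexive (cong (word v) (reverse-∷-++ x r (x ∷ c))))
      (word-repeat (reverse r) x c)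

  pieri : ∀ k l → (complete (suc k) ∘ₒ hookSum 0 l) ≋ (hookSum k (suc l) +ₒ hookSum (suc k) l)
  pieri k l = begin
    complete (suc k) ∘ₒ hookSum 0 l
      ≈⟨ ∘-cong (complete-suc k) (hookSum-column l) ⟩
    (∑[ x ∈ W ] ∑[ r ∈ ℒ k ] row x r) ∘ₒ (∑[ y ∈ W ] ∑[ c ∈ ℒ l ] column y c)
      ≈⟨ ∑-∘-∑ W W (λ x → ∑[ r ∈ ℒ k ] row x r) (λ y → ∑[ c ∈ ℒ l ] column y c) ⟩
    ∑[ x ∈ W ] ∑[ y ∈ W ] ((∑[ r ∈ ℒ k ] row x r) ∘ₒ (∑[ c ∈ ℒ l ] column y c))
      ≈⟨ ∑-cong W (λ x → ∑-cong W (λ y → ∑-∘-∑ (ℒ k) (ℒ l) (row x) (column y))) ⟩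
    ∑[ x ∈ W ] ∑[ y ∈ W ] ∑[ r ∈ ℒ k ] ∑[ c ∈ ℒ l ] (row x r ∘ₒ column y c)
      ≈⟨ ∑-split W (λ x → ∑-split W (λ y → ∑-split (ℒ k) (λ r → ∑-split (ℒ l) (λ c → product x r y c)))) ⟩
    (∑[ x ∈ W ] ∑[ y ∈ W ] ∑[ r ∈ ℒ k ] ∑[ c ∈ ℒ l ] cornerX x r y c)
      +ₒ (∑[ x ∈ W ] ∑[ y ∈ W ] ∑[ r ∈ ℒ k ] ∑[ c ∈ ℒ l ] cornerY x r y c)
      ≈⟨ +-cong cornerX-sum cornerY-sum ⟩
    hookSum k (suc l) +ₒ hookSum (suc k) l ∎
    where
    row column : ℤ → List ℤ → Op
    row x r    = when (strictInc (x ∷ r)) (word v (reverse (x ∷ r)))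
    column y c = when (strictInc (y ∷ c)) (word v (y ∷ c))
    cornerX cornerY : ℤ → List ℤ → ℤ → List ℤ → Op
    cornerX x r y c = when (strictInc (x ∷ r) ∧ strictInc (x ∷ y ∷ c)) (word v (reverse (x ∷ r) ++ y ∷ c))
    cornerY x r y c = when (strictInc (y ∷ x ∷ r) ∧ strictInc (y ∷ c)) (word v (reverse (y ∷ x ∷ r) ++ c))

    product : ∀ x r y c → (row x r ∘ₒ column y c) ≋ (cornerX x r y c +ₒ cornerY x r y c)
    product x r y c = ≋-trans (when-∘ (strictInc (x ∷ r)) (strictInc (y ∷ c)) _ _)
      (≋-trans (when-cong (strictInc (x ∷ r) ∧ strictInc (y ∷ c)) (≋-sym (word-++ (reverse (x ∷ r)) (y ∷ c))))
               (split-corner x r y c))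

    cornerX-sum : (∑[ x ∈ W ] ∑[ y ∈ W ] ∑[ r ∈ ℒ k ] ∑[ c ∈ ℒ l ] cornerX x r y c) ≋ hookSum k (suc l)
    cornerX-sum = ∑-cong W (λ x → ≋-trans (∑-comm W (ℒ k) (λ y r → ∑[ c ∈ ℒ l ] cornerX x r y c))
      (∑-cong (ℒ k) (λ r → ≋-sym (∑-listsOfLen-suc l W
        (λ c → when (strictInc (x ∷ r) ∧ strictInc (x ∷ c)) (word v (reverse (x ∷ r) ++ c)))))))

    cornerY-sum : (∑[ x ∈ W ] ∑[ y ∈ W ] ∑[ r ∈ ℒ k ] ∑[ c ∈ ℒ l ] cornerY x r y c) ≋ hookSum (suc k) l
    cornerY-sum = ≋-trans (∑-comm W W (λ x y → ∑[ r ∈ ℒ k ] ∑[ c ∈ ℒ l ] cornerY x r y c))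
      (∑-cong W (λ y → ≋-sym (∑-listsOfLen-suc k W (λ r → ∑[ c ∈ ℒ l ]
        when (strictInc (y ∷ r) ∧ strictInc (y ∷ c)) (word v (reverse (y ∷ r) ++ c))))))

  ∑-columnFillings : ∀ b (g : List (List ℤ) → Op) → ∑ (fillingsOf W (replicate b 1)) g ≋ ∑[ c ∈ ℒ b ] g (map [_] c)
  ∑-columnFillings zero    g = ≋-refl
  ∑-columnFillings (suc b) g = begin
    ∑ (fillingsOf W (replicate (suc b) 1)) g
      ≈⟨ ∑-concatMap (ℒ 1) (λ row → map (row ∷_) (fillingsOf W (replicate b 1))) g ⟩
    ∑[ row ∈ ℒ 1 ] ∑ (map (row ∷_) (fillingsOf W (replicate b 1))) g
      ≈⟨ ∑-cong (ℒ 1) (λ row → ≋-reflexive (∑-map (fillingsOf W (replicate b 1)) (row ∷_) g)) ⟩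
    ∑[ row ∈ ℒ 1 ] ∑[ cs ∈ fillingsOf W (replicate b 1) ] g (row ∷ cs)
      ≈⟨ ∑-listsOfLen-suc 0 W (λ row → ∑[ cs ∈ fillingsOf W (replicate b 1) ] g (row ∷ cs)) ⟩
    ∑[ x ∈ W ] ∑[ t ∈ ℒ 0 ] ∑[ cs ∈ fillingsOf W (replicate b 1) ] g ((x ∷ t) ∷ cs)
      ≈⟨ ∑-cong W (λ x → ∑-[ [] ] (λ t → ∑[ cs ∈ fillingsOf W (replicate b 1) ] g ((x ∷ t) ∷ cs))) ⟩
    ∑[ x ∈ W ] ∑[ cs ∈ fillingsOf W (replicate b 1) ] g ([ x ] ∷ cs)
      ≈⟨ ∑-cong W (λ x → ∑-columnFillings b (λ cs → g ([ x ] ∷ cs))) ⟩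
    ∑[ x ∈ W ] ∑[ c ∈ ℒ b ] g ([ x ] ∷ map [_] c)
      ≈⟨ ∑-listsOfLen-suc b W (λ c → g (map [_] c)) ⟨
    ∑[ c ∈ ℒ (suc b) ] g (map [_] c) ∎

  hookSum-fillings : ∀ a b →
    ∑[ T ∈ filterᵇ hookCondition (fillingsOf W (hook (suc a) b)) ] word v (reading T) ≋ hookSum a b
  hookSum-fillings a b = begin
    ∑[ T ∈ filterᵇ hookCondition (fillingsOf W (hook (suc a) b)) ] word v (reading T)
      ≈⟨ ∑-filterᵇ (fillingsOf W (hook (suc a) b)) hookCondition (word v ∘ reading) ⟩
    ∑ (fillingsOf W (hook (suc a) b)) term
      ≈⟨ ∑-concatMap (ℒ (suc a)) (λ row → map (row ∷_) (fillingsOf W (replicate b 1))) term ⟩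
    ∑[ row ∈ ℒ (suc a) ] ∑ (map (row ∷_) (fillingsOf W (replicate b 1))) term
      ≈⟨ ∑-cong (ℒ (suc a)) (λ row → ≋-reflexive (∑-map (fillingsOf W (replicate b 1)) (row ∷_) term)) ⟩
    ∑[ row ∈ ℒ (suc a) ] ∑[ cs ∈ fillingsOf W (replicate b 1) ] term (row ∷ cs)
      ≈⟨ ∑-cong (ℒ (suc a)) (λ row → ∑-columnFillings b (λ cs → term (row ∷ cs))) ⟩
    ∑[ row ∈ ℒ (suc a) ] ∑[ c ∈ ℒ b ] term (row ∷ map [_] c)
      ≈⟨ ∑-listsOfLen-suc a W (λ row → ∑[ c ∈ ℒ b ] term (row ∷ map [_] c)) ⟩
    ∑[ x ∈ W ] ∑[ r ∈ ℒ a ] ∑[ c ∈ ℒ b ] term ((x ∷ r) ∷ map [_] c)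
      ≈⟨ ∑-cong W (λ x → ∑-cong (ℒ a) (λ r → ∑-cong (ℒ b) (λ c → ≋-reflexive
           (cong₂ (λ col rd → when (strictInc (x ∷ r) ∧ strictInc (x ∷ col)) (word v (reverse (x ∷ r) ++ rd)))
                  (firstColumn c) (readColumn c))))) ⟩
    hookSum a b ∎
    where
    term : List (List ℤ) → Op
    term T = when (hookCondition T) (word v (reading T))
    firstColumn : ∀ (c : List ℤ) → concatMap (take 1) (map [_] c) ≡ c
    firstColumn []      = refl
    firstColumn (y ∷ c) = cong (y ∷_) (firstColumn c)
    readColumn : ∀ (c : List ℤ) → concatMap reverse (map [_] c) ≡ c
    readColumn []      = refl
    readColumn (y ∷ c) = cong (y ∷_) (readColumn c)

module Determinants where

  consecutive : ℕ → ℕ → List ℕ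
  consecutive k zero    = []
  consecutive k (suc m) = k ∷ consecutive (suc k) m

  length-consecutive : ∀ k m → length (consecutive k m) ≡ m
  length-consecutive k zero    = refl
  length-consecutive k (suc m) = cong suc (length-consecutive (suc k) m)

  applyUpTo-consecutive : ∀ (f : ℕ → ℕ) k m → (∀ x → f x ≡ k + x) → applyUpTo f m ≡ consecutive k m
  applyUpTo-consecutive f k zero    f≡ = refl
  applyUpTo-consecutive f k (suc m) f≡ = cong₂ _∷_ (trans (f≡ 0) (ℕ.+-identityʳ k))
    (applyUpTo-consecutive (f ∘ suc) (suc k) m (λ x → trans (f≡ (suc x)) (ℕ.+-suc k x)))

  upTo≡consecutive : ∀ m → upTo m ≡ consecutive 0 m
  upTo≡consecutive m = applyUpTo-consecutive id 0 m (λ _ → refl)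

  consecutive-All : ∀ {P : ℕ → Set} k m → (∀ {i} → k ≤ i → P i) → All P (consecutive k m)
  consecutive-All k zero    P≥k = []
  consecutive-All k (suc m) P≥k = P≥k ℕ.≤-refl ∷ consecutive-All (suc k) m (P≥k ∘ ℕ.<⇒≤)

  map-consecutive-cong : ∀ {A : Set} (f g : ℕ → A) k m → (∀ {i} → k ≤ i → i < k + m → f i ≡ g i) →
                         map f (consecutive k m) ≡ map g (consecutive k m)
  map-consecutive-cong f g k zero    f≡g = refl
  map-consecutive-cong f g k (suc m) f≡g = cong₂ _∷_ (f≡g ℕ.≤-refl (ℕ.m<m+n k (s≤s z≤n)))
    (map-consecutive-cong f g (suc k) m (λ {i} k<i i<k+m → f≡g (ℕ.<⇒≤ k<i) (subst (i <_) (sym (ℕ.+-suc k m)) i<k+m)))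

  map-consecutive-shift : ∀ {A : Set} (f : ℕ → A) s k m →
                          map f (consecutive (s + k) m) ≡ map (f ∘ (_+_ s)) (consecutive k m)
  map-consecutive-shift f s k zero    = refl
  map-consecutive-shift f s k (suc m) = cong (f (s + k) ∷_)
    (trans (cong (λ z → map f (consecutive z m)) (sym (ℕ.+-suc s k))) (map-consecutive-shift f s (suc k) m))

  dropIdx-map : ∀ {A B : Set} (f : A → B) j xs → dropIdx j (map f xs) ≡ map f (dropIdx j xs)
  dropIdx-map f j       []       = refl
  dropIdx-map f zero    (x ∷ xs) = refl
  dropIdx-map f (suc j) (x ∷ xs) = cong (f x ∷_) (dropIdx-map f j xs)

  length-dropIdx : ∀ {A : Set} j (xs : List A) → j < length xs → suc (length (dropIdx j xs)) ≡ length xs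
  length-dropIdx zero    (x ∷ xs) _         = refl
  length-dropIdx (suc j) (x ∷ xs) (s≤s j<n) = cong suc (length-dropIdx j xs j<n)

  dropIdx-consecutive : ∀ j k m → j ≤ m →
                        dropIdx j (consecutive k (suc m)) ≡ consecutive k j ++ consecutive (suc (j + k)) (m ∸ j)
  dropIdx-consecutive zero    k m       _         = refl
  dropIdx-consecutive (suc j) k (suc m) (s≤s j≤m) = cong (k ∷_)
    (trans (dropIdx-consecutive j (suc k) m j≤m)
           (cong (λ z → consecutive (suc k) j ++ consecutive (suc z) (m ∸ j)) (ℕ.+-suc j k)))

  lookupD-map-consecutive : ∀ (f : ℕ → Op) k m j → j < m → lookupD (map f (consecutive k m)) j ≡ f (k + j)
  lookupD-map-consecutive f k (suc m) zero    _         = cong f (sym (ℕ.+-identityʳ k))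
  lookupD-map-consecutive f k (suc m) (suc j) (s≤s j<m) =
    trans (lookupD-map-consecutive f (suc k) m j j<m) (cong f (sym (ℕ.+-suc k j)))

  matrix : (ℕ → ℕ → Op) → List ℕ → List ℕ → List (List Op)
  matrix E R C = map (λ i → map (E i) C) R

  subdet : (ℕ → ℕ → Op) → List ℕ → List ℕ → Op
  subdet E R C = detF (length R) (matrix E R C)

  sign : ℕ → Op → Op
  sign j = if isEven j then (λ f → f) else negOp

  sign-cong : ∀ j {f g} → f ≋ g → sign j f ≋ sign j g
  sign-cong j f≋g with isEven j
  ... | true  = f≋g
  ... | false = neg-cong f≋g

  sign-zero : ∀ j {f} → f ≋ zeroOp → sign j f ≋ zeroOp
  sign-zero j f≋0 with isEven j
  ... | true  = f≋0
  ... | false = ≋-trans (neg-cong f≋0) neg-zero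

  sign-suc : ∀ j f → sign (suc j) f ≋ negOp (sign j f)
  sign-suc zero          f = ≋-refl
  sign-suc (suc zero)    f = ≋-sym (neg-involutive f)
  sign-suc (suc (suc j)) f = sign-suc j f

  laplace : ∀ E i R C → subdet E (i ∷ R) C ≋
    ∑[ j ∈ upTo (length C) ] sign j (lookupD (map (E i) C) j ∘ₒ subdet E R (dropIdx j C))
  laplace E i R C rewrite List.length-map (E i) C = ∑-cong (upTo (length C)) λ j → ≋-reflexive
    (cong (λ M → sign j (lookupD (map (E i) C) j ∘ₒ detF (length R) M)) (map-dropIdx-matrix R))
    where
    map-dropIdx-matrix : ∀ {j} R → map (dropIdx j) (matrix E R C) ≡ matrix E R (dropIdx j C)
    map-dropIdx-matrix []      = refl
    map-dropIdx-matrix {j} (i ∷ R) = cong₂ _∷_ (dropIdx-map (E i) j C) (map-dropIdx-matrix R)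

  subdet-zeroColumn : ∀ E R c C → length R ≡ suc (length C) → All (λ i → E i c ≋ zeroOp) R →
                      subdet E R (c ∷ C) ≋ zeroOp

  -- Every minor of a later entry of row i keeps the column c, which vanishes on R.
  laplace-zeroColumn : ∀ E i R c C → length R ≡ length C → All (λ i′ → E i′ c ≋ zeroOp) R →
                       subdet E (i ∷ R) (c ∷ C) ≋ (E i c ∘ₒ subdet E R C)
  laplace-zeroColumn E i R c C len E≋0s = ≋-trans (laplace E i R (c ∷ C))
    (≋-trans (+-cong (≋-refl {E i c ∘ₒ subdet E R C}) (∑-zero-All (All.applyUpTo⁺₁ suc (length C) later)))
             (+-identityʳ (E i c ∘ₒ subdet E R C)))
    where
    later : ∀ {j} → j < length C →
            sign (suc j) (lookupD (map (E i) (c ∷ C)) (suc j) ∘ₒ subdet E R (c ∷ dropIdx j C)) ≋ zeroOp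
    later {j} j<len = sign-zero (suc j) (≋-trans
      (∘-congʳ (lookupD (map (E i) C) j)
        (subdet-zeroColumn E R c (dropIdx j C) (trans len (sym (length-dropIdx j C j<len))) E≋0s))
      (∘-zeroʳ (lookupD (map (E i) C) j)))

  subdet-zeroColumn E (i ∷ R) c C len (E≋0 ∷ E≋0s) = ≋-trans
    (laplace-zeroColumn E i R c C (ℕ.suc-injective len) E≋0s)
    (≋-trans (∘-congˡ (subdet E R C) E≋0) (∘-zeroˡ (subdet E R C)))

  subdet-unitColumn : ∀ E c R C → E (suc c) c ≋ idOp → All (λ i → E i c ≋ zeroOp) R → length R ≡ length C →
                      subdet E (suc c ∷ R) (c ∷ C) ≋ subdet E R C
  subdet-unitColumn E c R C E≋1 E≋0s len = ≋-trans (laplace-zeroColumn E (suc c) R c C len E≋0s)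
    (≋-trans (∘-congˡ (subdet E R C) E≋1) (∘-identityˡ (subdet E R C)))

  subdet-unitriangular : ∀ E → (∀ c → E (suc c) c ≋ idOp) → (∀ i c → suc c < i → E i c ≋ zeroOp) →
    ∀ t k m C → length C ≡ m →
    subdet E (consecutive (suc k) (t + m)) (consecutive k t ++ C) ≋ subdet E (consecutive (t + suc k) m) C
  subdet-unitriangular E E≋1 E≋0 zero    k m C len = ≋-refl
  subdet-unitriangular E E≋1 E≋0 (suc t) k m C len =
    ≋-trans (subdet-unitColumn E k (consecutive (suc (suc k)) (t + m)) (consecutive (suc k) t ++ C) (E≋1 k)
               (consecutive-All (suc (suc k)) (t + m) (λ {i} → E≋0 i k))
               (trans (length-consecutive (suc (suc k)) (t + m))
                 (sym (trans (List.length-++ (consecutive (suc k) t)) (cong₂ _+_ (length-consecutive (suc k) t) len)))))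
    (≋-trans (subdet-unitriangular E E≋1 E≋0 t (suc k) m C len)
       (≋-reflexive (cong (λ s → subdet E (consecutive s m) C) (ℕ.+-suc t (suc k)))))

open Determinants

jacobiTrudi : (ℤ → Op) → List ℕ → Op
jacobiTrudi h κ = det (map (λ i → map (λ j → h ((+ rowLen κ i ℤ.- + i) ℤ.+ + j)) (upTo (length κ)))
                           (upTo (length κ)))

module HookExpansion (h : ℤ → Op) (h-zero : h (+ 0) ≋ idOp) (h-neg : ∀ k → h -[1+ k ] ≋ zeroOp) where

  entry : List ℕ → ℕ → ℕ → Op
  entry κ i j = h ((+ rowLen κ i ℤ.- + i) ℤ.+ + j)

  -- Jacobi–Trudi entries of rows of length 1, whose determinant is e_m.
  unitEntry : ℕ → ℕ → Op
  unitEntry i j = h ((+ 1 ℤ.- + i) ℤ.+ + j)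

  elementary : ℕ → Op
  elementary m = subdet unitEntry (consecutive 0 m) (consecutive 0 m)

  unitEntry-diagonal : ∀ c → unitEntry (suc c) c ≋ idOp
  unitEntry-diagonal c = ≋-trans (≋-reflexive (cong h index≡0)) h-zero
    where
    index≡0 : (+ 1 ℤ.- + suc c) ℤ.+ + c ≡ + 0
    index≡0 = trans (cong (λ z → (+ 1 ℤ.- z) ℤ.+ + c) (ℤₚ.pos-+ 1 c)) (cancel (+ c))
      where
      cancel : ∀ x → (+ 1 ℤ.- (+ 1 ℤ.+ x)) ℤ.+ x ≡ + 0
      cancel = solve-∀

  unitEntry-below : ∀ i c → suc c < i → unitEntry i c ≋ zeroOp
  unitEntry-below i c c+1<i = ≋-trans (≋-reflexive (cong h index<0)) (h-neg d)
    where
    d = i ∸ suc (suc c)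
    index<0 : (+ 1 ℤ.- + i) ℤ.+ + c ≡ -[1+ d ]
    index<0 = begin
      (+ 1 ℤ.- + i) ℤ.+ + c                                 ≡⟨ cong (λ z → (+ 1 ℤ.- + z) ℤ.+ + c) (ℕ.m+[n∸m]≡n c+1<i) ⟨
      (+ 1 ℤ.- + (2 + c + d)) ℤ.+ + c                       ≡⟨ cong (λ z → (+ 1 ℤ.- z) ℤ.+ + c) (ℤₚ.pos-+ (2 + c) d) ⟩
      (+ 1 ℤ.- (+ (2 + c) ℤ.+ + d)) ℤ.+ + c                 ≡⟨ cong (λ z → (+ 1 ℤ.- (z ℤ.+ + d)) ℤ.+ + c) (ℤₚ.pos-+ 2 c) ⟩
      (+ 1 ℤ.- ((+ 2 ℤ.+ + c) ℤ.+ + d)) ℤ.+ + c             ≡⟨ simplify (+ c) (+ d) ⟩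
      ℤ.- (+ 1 ℤ.+ + d)                                     ≡⟨ cong ℤ.-_ (ℤₚ.pos-+ 1 d) ⟨
      -[1+ d ]                                              ∎
      where
      open ≡-Reasoning
      simplify : ∀ x y → (+ 1 ℤ.- ((+ 2 ℤ.+ x) ℤ.+ y)) ℤ.+ x ≡ ℤ.- (+ 1 ℤ.+ y)
      simplify = solve-∀

  unitEntry-shift : ∀ s i j → unitEntry (s + i) (s + j) ≡ unitEntry i j
  unitEntry-shift s i j = cong h (trans
    (cong₂ (λ p q → (+ 1 ℤ.- p) ℤ.+ q) (ℤₚ.pos-+ s i) (ℤₚ.pos-+ s j)) (cancel (+ s) (+ i) (+ j)))
    where
    cancel : ∀ a b c → (+ 1 ℤ.- (a ℤ.+ b)) ℤ.+ (a ℤ.+ c) ≡ (+ 1 ℤ.- b) ℤ.+ c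
    cancel = solve-∀

  elementary-shift : ∀ s m → subdet unitEntry (consecutive s m) (consecutive s m) ≡ elementary m
  elementary-shift s m rewrite sym (ℕ.+-identityʳ s) =
    cong₂ detF (trans (length-consecutive (s + 0) m) (sym (length-consecutive 0 m)))
      (trans (map-consecutive-shift (λ i → map (unitEntry i) (consecutive (s + 0) m)) s 0 m)
        (List.map-cong (λ i → trans (map-consecutive-shift (unitEntry (s + i)) s 0 m)
                                    (List.map-cong (unitEntry-shift s i) (consecutive 0 m)))
                       (consecutive 0 m)))

  jacobiTrudi≡subdet : ∀ κ →
    jacobiTrudi h κ ≡ subdet (entry κ) (consecutive 0 (length κ)) (consecutive 0 (length κ))
  jacobiTrudi≡subdet κ rewrite upTo≡consecutive (length κ) =
    cong (λ m → detF m (matrix (entry κ) (consecutive 0 (length κ)) (consecutive 0 (length κ))))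
    (List.length-map (λ i → map (entry κ i) (consecutive 0 (length κ))) (consecutive 0 (length κ)))

  length-hook : ∀ a b → length (hook a b) ≡ suc b
  length-hook a b = cong suc (List.length-replicate b)

  rowLen-replicate : ∀ b i → i < b → rowLen (replicate b 1) i ≡ 1
  rowLen-replicate (suc b) zero    _         = refl
  rowLen-replicate (suc b) (suc i) (s≤s i<b) = rowLen-replicate b i i<b

  entry-hook-leg : ∀ a b i → i < b → entry (hook a b) (suc i) ≡ unitEntry (suc i)
  entry-hook-leg a b i i<b = cong (λ r j → h ((+ r ℤ.- + suc i) ℤ.+ + j)) (rowLen-replicate b i i<b)

  entry-column : ∀ m i → i < suc m → entry (hook 1 m) i ≡ unitEntry i
  entry-column m zero    _         = refl
  entry-column m (suc i) (s≤s i<m) = entry-hook-leg 1 m i i<m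

  jacobiTrudi-column : ∀ m → jacobiTrudi h (hook 1 m) ≡ elementary (suc m)
  jacobiTrudi-column m = begin
    jacobiTrudi h (hook 1 m)
      ≡⟨ jacobiTrudi≡subdet (hook 1 m) ⟩
    subdet (entry (hook 1 m)) (consecutive 0 (length (hook 1 m))) (consecutive 0 (length (hook 1 m)))
      ≡⟨ cong (λ ℓ → subdet (entry (hook 1 m)) (consecutive 0 ℓ) (consecutive 0 ℓ)) (length-hook 1 m) ⟩
    subdet (entry (hook 1 m)) (consecutive 0 (suc m)) (consecutive 0 (suc m))
      ≡⟨ cong (detF (length (consecutive 0 (suc m))))
              (map-consecutive-cong _ _ 0 (suc m) λ {i} _ i<1+m →
                 cong (λ e → map e (consecutive 0 (suc m))) (entry-column m i i<1+m)) ⟩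
    elementary (suc m) ∎
    where open ≡-Reasoning

  hook-leg-minor : ∀ a b j → j ≤ b →
    subdet (entry (hook a b)) (consecutive 1 b) (dropIdx j (consecutive 0 (suc b))) ≋ elementary (b ∸ j)
  hook-leg-minor a b j j≤b = begin
    subdet (entry (hook a b)) (consecutive 1 b) (dropIdx j (consecutive 0 (suc b)))
      ≡⟨ cong (subdet (entry (hook a b)) (consecutive 1 b)) (dropIdx-consecutive j 0 b j≤b) ⟩
    subdet (entry (hook a b)) (consecutive 1 b) (consecutive 0 j ++ C)
      ≡⟨ cong (detF (length (consecutive 1 b))) (map-consecutive-cong _ _ 1 b λ { {suc i} _ (s≤s i<b) →
           cong (λ e → map e (consecutive 0 j ++ C)) (entry-hook-leg a b i i<b) }) ⟩
    subdet unitEntry (consecutive 1 b) (consecutive 0 j ++ C)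
      ≡⟨ cong (λ m → subdet unitEntry (consecutive 1 m) (consecutive 0 j ++ C)) (ℕ.m+[n∸m]≡n j≤b) ⟨
    subdet unitEntry (consecutive 1 (j + (b ∸ j))) (consecutive 0 j ++ C)
      ≈⟨ subdet-unitriangular unitEntry unitEntry-diagonal unitEntry-below j 0 (b ∸ j) C (length-consecutive _ (b ∸ j)) ⟩
    subdet unitEntry (consecutive (j + 1) (b ∸ j)) C
      ≡⟨ cong₂ (λ p q → subdet unitEntry (consecutive p (b ∸ j)) (consecutive q (b ∸ j)))
               (ℕ.+-comm j 1) (cong suc (ℕ.+-identityʳ j)) ⟩
    subdet unitEntry (consecutive (suc j) (b ∸ j)) (consecutive (suc j) (b ∸ j))
      ≡⟨ elementary-shift (suc j) (b ∸ j) ⟩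
    elementary (b ∸ j) ∎
    where
    open SetoidReasoning ≋-setoid
    C = consecutive (suc (j + 0)) (b ∸ j)

  jacobiTrudi-hook : ∀ a b →
    jacobiTrudi h (hook a b) ≋ ∑[ j ∈ upTo (suc b) ] sign j (h (+ (a + j)) ∘ₒ elementary (b ∸ j))
  jacobiTrudi-hook a b = begin
    jacobiTrudi h (hook a b)
      ≡⟨ jacobiTrudi≡subdet (hook a b) ⟩
    subdet E (consecutive 0 (length (hook a b))) (consecutive 0 (length (hook a b)))
      ≡⟨ cong (λ ℓ → subdet E (consecutive 0 ℓ) (consecutive 0 ℓ)) (length-hook a b) ⟩
    subdet E (consecutive 0 (suc b)) (consecutive 0 (suc b))
      ≈⟨ laplace E 0 (consecutive 1 b) (consecutive 0 (suc b)) ⟩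
    ∑[ j ∈ upTo (length (consecutive 0 (suc b))) ] term j
      ≡⟨ cong (λ m → ∑[ j ∈ upTo m ] term j) (length-consecutive 0 (suc b)) ⟩
    ∑[ j ∈ upTo (suc b) ] term j
      ≈⟨ ∑-cong-All (All.applyUpTo⁺₁ id (suc b) λ {j} j<1+b → sign-cong j (∘-cong
           (≋-reflexive (trans (lookupD-map-consecutive (E 0) 0 (suc b) j j<1+b) (cong h (top-index j))))
           (hook-leg-minor a b j (ℕ.≤-pred j<1+b)))) ⟩
    ∑[ j ∈ upTo (suc b) ] sign j (h (+ (a + j)) ∘ₒ elementary (b ∸ j)) ∎
    where
    open SetoidReasoning ≋-setoid
    E = entry (hook a b)
    term : ℕ → Op
    term j = sign j (lookupD (map (E 0) (consecutive 0 (suc b))) j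
                     ∘ₒ subdet E (consecutive 1 b) (dropIdx j (consecutive 0 (suc b))))
    top-index : ∀ j → (+ a ℤ.- + 0) ℤ.+ + j ≡ + (a + j)
    top-index j = trans (cong (ℤ._+ + j) (ℤₚ.+-identityʳ (+ a))) (sym (ℤₚ.pos-+ a j))

module JacobiTrudiForHooks (v : ℤ → Op) (v∘v≋0 : ∀ i → (v i ∘ₒ v i) ≋ zeroOp) {W : List ℤ} (W↑ : Sorted W)
  (h : ℤ → Op) (h-pos : ∀ k → h (+ k) ≋ Hooks.complete v v∘v≋0 W↑ k) (h-neg : ∀ k → h -[1+ k ] ≋ zeroOp) where
  open SetoidReasoning ≋-setoid

  open Hooks v v∘v≋0 W↑ using (complete; hookSum; pieri; complete≋hookSum-row)

  h-zero : h (+ 0) ≋ idOp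
  h-zero = ≋-trans (h-pos 0) (+-identityʳ idOp)

  open HookExpansion h h-zero h-neg using (elementary; jacobiTrudi-column; jacobiTrudi-hook)

  pieriTerm : ℕ → ℕ → Op
  pieriTerm k zero    = hookSum k 0
  pieriTerm k (suc l) = hookSum k (suc l) +ₒ hookSum (suc k) l

  h∘elementary : ∀ k l → (∀ {l′} → suc l′ ≡ l → jacobiTrudi h (hook 1 l′) ≋ hookSum 0 l′) →
                 (h (+ suc k) ∘ₒ elementary l) ≋ pieriTerm k l
  h∘elementary k zero    _  = ≋-trans (∘-identityʳ (h (+ suc k))) (≋-trans (h-pos (suc k)) (complete≋hookSum-row k))
  h∘elementary k (suc l) ih = begin
    h (+ suc k) ∘ₒ elementary (suc l)          ≡⟨ cong (h (+ suc k) ∘ₒ_) (jacobiTrudi-column l) ⟨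
    h (+ suc k) ∘ₒ jacobiTrudi h (hook 1 l)   ≈⟨ ∘-cong (h-pos (suc k)) (ih refl) ⟩
    complete (suc k) ∘ₒ hookSum 0 l            ≈⟨ pieri k l ⟩
    pieriTerm k (suc l)                        ∎

  -- Consecutive Pieri terms share a hook sum with opposite signs.
  telescope : ∀ b a → ∑[ j ∈ upTo (suc b) ] sign j (pieriTerm (a + j) (b ∸ j)) ≋ hookSum a b
  telescope zero    a =
    ≋-trans (+-identityʳ (hookSum (a + 0) 0)) (≋-reflexive (cong (λ k → hookSum k 0) (ℕ.+-identityʳ a)))
  telescope (suc b) a = begin
    term 0 +ₒ ∑ (applyUpTo suc (suc b)) term
      ≈⟨ +-cong (≋-reflexive (cong (λ k → pieriTerm k (suc b)) (ℕ.+-identityʳ a)))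
                (≋-reflexive (trans (cong (λ L → ∑ L term) (sym (List.map-upTo suc (suc b))))
                                    (∑-map (upTo (suc b)) suc term))) ⟩
    pieriTerm a (suc b) +ₒ (∑[ j ∈ upTo (suc b) ] term (suc j))
      ≈⟨ +-cong (≋-refl {pieriTerm a (suc b)}) (∑-cong (upTo (suc b)) λ j → ≋-trans
           (sign-suc j (pieriTerm (a + suc j) (b ∸ j)))
           (≋-reflexive (cong (λ k → negOp (sign j (pieriTerm k (b ∸ j)))) (ℕ.+-suc a j)))) ⟩
    pieriTerm a (suc b) +ₒ (∑[ j ∈ upTo (suc b) ] negOp (sign j (pieriTerm (suc a + j) (b ∸ j))))
      ≈⟨ +-cong (≋-refl {pieriTerm a (suc b)})
           (≋-trans (∑-neg (upTo (suc b)) (λ j → sign j (pieriTerm (suc a + j) (b ∸ j))))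
                    (neg-cong (telescope b (suc a)))) ⟩
    (hookSum a (suc b) +ₒ hookSum (suc a) b) +ₒ negOp (hookSum (suc a) b)
      ≈⟨ +-assoc (hookSum a (suc b)) (hookSum (suc a) b) (negOp (hookSum (suc a) b)) ⟩
    hookSum a (suc b) +ₒ (hookSum (suc a) b +ₒ negOp (hookSum (suc a) b))
      ≈⟨ +-cong (≋-refl {hookSum a (suc b)}) (+-inverseʳ (hookSum (suc a) b)) ⟩
    hookSum a (suc b) +ₒ zeroOp
      ≈⟨ +-identityʳ (hookSum a (suc b)) ⟩
    hookSum a (suc b) ∎
    where
    term : ℕ → Op
    term j = sign j (pieriTerm (a + j) (suc b ∸ j))

  jacobiTrudi-hook≋hookSum : ∀ b a → jacobiTrudi h (hook (suc a) b) ≋ hookSum a b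
  jacobiTrudi-hook≋hookSum = <-rec (λ b → ∀ a → jacobiTrudi h (hook (suc a) b) ≋ hookSum a b) λ b ih a → begin
    jacobiTrudi h (hook (suc a) b)
      ≈⟨ jacobiTrudi-hook (suc a) b ⟩
    ∑[ j ∈ upTo (suc b) ] sign j (h (+ (suc a + j)) ∘ₒ elementary (b ∸ j))
      ≈⟨ ∑-cong (upTo (suc b)) (λ j → sign-cong j (h∘elementary (a + j) (b ∸ j) λ {l′} 1+l′≡b∸j →
           ih (ℕ.≤-trans (ℕ.≤-reflexive 1+l′≡b∸j) (ℕ.m∸n≤m b j)) 0)) ⟩
    ∑[ j ∈ upTo (suc b) ] sign j (pieriTerm (a + j) (b ∸ j))
      ≈⟨ telescope b a ⟩
    hookSum a b ∎

schurTrunc-hook≋fillingSum : ∀ {n} → 1 ≤ n → ∀ N a b →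
                             schurTrunc n N (hook (suc a) b) ≋ fillingSum n N (hook (suc a) b)
schurTrunc-hook≋fillingSum {n} 1≤n N a b =
  ≋-trans (jacobiTrudi-hook≋hookSum b a) (≋-sym (Hooks.hookSum-fillings (u n) (u∘u≋0 1≤n) (window-sorted N) a b))
  where
  -- hTrunc n N and uWord n unfold to Hooks.complete and word for v = u n.
  open JacobiTrudiForHooks (u n) (u∘u≋0 1≤n) (window-sorted N) (hTrunc n N) (λ _ → ≋-refl) (λ _ → ≋-refl)

theorem7p3 : ∀ (n : ℕ) → 1 ≤ n → ∀ (a b : ℕ) → 1 ≤ a →
    ∀ (κ : List ℕ) → IsPartition κ →
    ∃[ N₀ ] (∀ (N : ℕ) → N₀ ≤ N →
    schurTrunc n N (hook a b) κ ≈ fillingSum n N (hook a b) κ)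
theorem7p3 n 1≤n (suc a) b _ κ _ = 0 , λ N _ → app-≈ (schurTrunc-hook≋fillingSum 1≤n N a b) κ
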